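{- Let $t\ge 2$ be an integer, $\alpha=\big(2-t+\sqrt{t^2+4}\,\big)/2$, $A(n)=\lfloor n\alpha\rfloor$ for $n\ge1$, and let $\Delta AA$ be the infinite word $(A(A(n+1))-A(A(n)))_{n\ge 1}$. Then $\Delta AA$ is a morphic word; in fact $\Delta AA=\delta(x)$ where $x$ is a fixed point of a morphism $\tau$ on the alphabet $\{1,2,\dots,t+1\}$ and $\delta$ is a morphism on the same alphabet, given as follows. For $t=2$: $\tau(1)=12,\ \tau(2)=131,\ \tau(3)=121$; $\delta(1)=13,\ \delta(2)=222,\ \delta(3)=132$. For $t=3$: $\tau(1)=123,\ \tau(2)=124,\ \tau(3)=1141,\ \tau(4)=1241$; $\delta(1)=113,\ \delta(2)=122,\ \delta(3)=2122,\ \delta(4)=1222$. For $t\ge 4$ (writing $[t-j]$ for the letter $t-j$): $\tau(1)=1\,2\cdots[t-1]\,t$, $\tau(2)=1\,2\cdots[t-1]\,[t+1]$, for $j=3,\dots,t-1$: $\tau(j)=1\,2\cdots[t-j]\,[t-j+1]\,[t-j+1]\,[t-j+2]\cdots[t-2]\,[t+1]$, $\tau(t)=1\,1\,2\cdots[t-2]\,[t+1]\,1$, $\tau(t+1)=1\,2\,2\,3\cdots[t-2]\,[t+1]\,1$; and $\delta(1)=1^{t-1}3$, $\delta(2)=1^{t-2}22$, $\delta(j)=1^{t-j}\,2\,1^{j-2}\,2$ for $j=3,\dots,t-1$, $\delta(t)=2\,1^{t-2}\,22$, $\delta(t+1)=12\,1^{t-3}\,22$.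
   Context: A morphism on a finite alphabet maps each letter to a finite word and extends to words and infinite words by concatenation. A fixed point of $\tau$ is an infinite word $x$ with $\tau(x)=x$. A morphic word is the image under a letter-to-letter map of a fixed point of a morphism. Here $\Delta AA$ is regarded as an infinite word over the positive integers, and $\delta(x)$ denotes the concatenation $\delta(x_1)\delta(x_2)\cdots$ (a "decoration" of $x$). In the formulas, $1\,2\cdots k$ denotes the word of consecutive letters from $1$ to $k$, and $1^m$ denotes $m$ copies of the letter $1$. -}

module Defs where

open import Data.Nat using (ℕ; zero; suc; _+_; _*_; _∸_; _^_; _≤_; _<_; _≡ᵇ_; _≤ᵇ_)
open import Data.Bool using (Bool; true; false; if_then_else_; _∧_)
open import Data.List using (List; []; _∷_; _++_; [_]; map; upTo; replicate; applyUpTo; concatMap; length; take)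
open import Data.Product using (_×_; ∃-syntax)
open import Relation.Binary.PropositionalEquality using (_≡_)

-- The floor function n ↦ ⌊ n α ⌋, α = (2 - t + √(t²+4)) / 2, t ≥ 2.
-- For n ≥ 1 and t ≥ 2:
--   m ≤ n α      ⟺  2m + n(t-2) ≤ n √(t²+4)  ⟺  (2m + n(t-2))² ≤ n²(t²+4)
--   n α < m + 1  ⟺  n²(t²+4) < (2(m+1) + n(t-2))²
-- (both sides non-negative, so squaring is an equivalence).

IsFloorα : (t n m : ℕ) → Set
IsFloorα t n m =
  ((2 * m + n * (t ∸ 2)) ^ 2 ≤ n ^ 2 * (t ^ 2 + 4)) ×
  (n ^ 2 * (t ^ 2 + 4) < (2 * (m + 1) + n * (t ∸ 2)) ^ 2)

-- Infinite words are functions ℕ → ℕ (position 0 is the first letter).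

Word : Set
Word = ℕ → ℕ

pref : Word → ℕ → List ℕ
pref w k = applyUpTo w k

-- IsImage f x y : the infinite word y equals f(x) = f(x₀) f(x₁) ⋯,
-- i.e. f(x₀⋯x_{k-1}) is a prefix of y for every k, and these prefixes
-- have unbounded length (so f(x) is indeed infinite).
IsImage : (ℕ → List ℕ) → Word → Word → Set
IsImage f x y =
  (∀ k → pref y (length (concatMap f (pref x k))) ≡ concatMap f (pref x k)) ×
  (∀ N → ∃[ k ] (N ≤ length (concatMap f (pref x k))))

-- The word Δ A A, where (Δ A A)_n = A(A(n+1)) - A(A(n)) for n ≥ 1;
-- position i of the Word corresponds to n = i + 1.

ΔAA : (ℕ → ℕ) → Word
ΔAA A i = A (A (i + 2)) ∸ A (A (i + 1))

-- seg a b = a (a+1) ⋯ b   (empty if b < a)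
seg : ℕ → ℕ → List ℕ
seg a b = map (a +_) (upTo (suc b ∸ a))

rep : ℕ → ℕ → List ℕ
rep m c = replicate m c

-- The morphisms τ and δ (letters outside {1,…,t+1} are sent to []).

τ2 : ℕ → List ℕ
τ2 1 = 1 ∷ 2 ∷ []
τ2 2 = 1 ∷ 3 ∷ 1 ∷ []
τ2 3 = 1 ∷ 2 ∷ 1 ∷ []
τ2 _ = []

δ2 : ℕ → List ℕ
δ2 1 = 1 ∷ 3 ∷ []
δ2 2 = 2 ∷ 2 ∷ 2 ∷ []
δ2 3 = 1 ∷ 3 ∷ 2 ∷ []
δ2 _ = []

τ3 : ℕ → List ℕ
τ3 1 = 1 ∷ 2 ∷ 3 ∷ []
τ3 2 = 1 ∷ 2 ∷ 4 ∷ []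
τ3 3 = 1 ∷ 1 ∷ 4 ∷ 1 ∷ []
τ3 4 = 1 ∷ 2 ∷ 4 ∷ 1 ∷ []
τ3 _ = []

δ3 : ℕ → List ℕ
δ3 1 = 1 ∷ 1 ∷ 3 ∷ []
δ3 2 = 1 ∷ 2 ∷ 2 ∷ []
δ3 3 = 2 ∷ 1 ∷ 2 ∷ 2 ∷ []
δ3 4 = 1 ∷ 2 ∷ 2 ∷ 2 ∷ []
δ3 _ = []

τgen : ℕ → ℕ → List ℕ
τgen t j =
  if j ≡ᵇ 1 then seg 1 t
  else if j ≡ᵇ 2 then seg 1 (t ∸ 1) ++ [ t + 1 ]
  else if j ≡ᵇ t then 1 ∷ seg 1 (t ∸ 2) ++ (t + 1) ∷ 1 ∷ []
  else if j ≡ᵇ t + 1 then 1 ∷ 2 ∷ seg 2 (t ∸ 2) ++ (t + 1) ∷ 1 ∷ []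
  else if (3 ≤ᵇ j) ∧ (j ≤ᵇ t ∸ 1)
    then seg 1 (t ∸ j + 1) ++ seg (t ∸ j + 1) (t ∸ 2) ++ [ t + 1 ]
  else []

δgen : ℕ → ℕ → List ℕ
δgen t j =
  if j ≡ᵇ 1 then rep (t ∸ 1) 1 ++ [ 3 ]
  else if j ≡ᵇ 2 then rep (t ∸ 2) 1 ++ 2 ∷ 2 ∷ []
  else if j ≡ᵇ t then 2 ∷ rep (t ∸ 2) 1 ++ 2 ∷ 2 ∷ []
  else if j ≡ᵇ t + 1 then 1 ∷ 2 ∷ rep (t ∸ 3) 1 ++ 2 ∷ 2 ∷ []
  else if (3 ≤ᵇ j) ∧ (j ≤ᵇ t ∸ 1)
    then rep (t ∸ j) 1 ++ 2 ∷ rep (j ∸ 2) 1 ++ [ 2 ]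
  else []

τ : ℕ → ℕ → List ℕ
τ 2 = τ2
τ 3 = τ3
τ t = τgen t

δ : ℕ → ℕ → List ℕ
δ 2 = δ2
δ 3 = δ3
δ t = δgen t

-- Write α = 1 + β, where β = [0; t, t, …] is the positive root of β² + tβ = 1, and call the letters
-- t and t + 1 of the fixed point x of τ large. Each τ(j) contains exactly one large letter, its t-th,
-- so the number C m of large letters among the first m letters of x obeys the same self-similarity
-- as ⌊(m + 1)β⌋; as β is irrational this forces A (m + 1) = m + 1 + C m. Hence the difference word
-- ΔA is ρ(x) with ρ = 1 + [large], a fixed point of the Sturmian morphism φ : 1 ↦ 1^(t−1) 2,
-- 2 ↦ 1^(t−1) 2 1. Moreover ΔAA is obtained by cutting ΔA into consecutive blocks of lengths
-- ΔA 0, ΔA 1, … and summing each block. Both ζ(x) and ρ(τ(x)) equal ΔA for a suitable decoration ζ,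
-- and δ(j) is ζ(j) cut according to ρ(τ(j)) and summed, so δ(x) = ΔAA; what remains are letterwise
-- identities between τ, δ, ζ, ρ and φ, checked separately for t = 2, t = 3 and t ≥ 4.

module Submission where

open import Defs
open import Data.Nat
open import Data.Nat.Properties
open import Data.Nat.Induction using (<-rec)
open import Data.Nat.ListAction using (sum)
open import Data.Nat.ListAction.Properties using (sum-++)
open import Data.Nat.Tactic.RingSolver using (solve-∀)
open import Data.Bool using (true; false; T; if_then_else_)
open import Data.Bool.Properties using (T-≡)
open import Data.List using (List; []; _∷_; _++_; [_]; map; applyUpTo; upTo; concatMap; length; take; drop)
open import Data.List.Properties
  using (∷-injective; map-∘; ++-assoc; ++-identityʳ; ++-monoid; length-++; length-map; length-drop; length-replicate;
         length-applyUpTo; map-++; map-upTo; map-applyUpTo; applyUpTo-∷ʳ; concatMap-++; take-map; take++drop≡id)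
open import Data.List.Relation.Unary.All using (All; []; _∷_)
open import Data.Product using (_×_; _,_; proj₁; proj₂; ∃-syntax)
open import Data.Sum using (inj₁; inj₂)
open import Data.Empty using (⊥-elim)
open import Function.Base using (_∘′_)
open import Function.Bundles using (Equivalence)
open import Relation.Nullary using (yes; no)
open import Relation.Binary.PropositionalEquality hiding ([_])
open import Tactic.MonoidSolver using () renaming (solve to solve-monoid)

-- The floor function n ↦ ⌊nα⌋

disc : ℕ → ℕ
disc s = (2 + s) * (2 + s) + 4

IsFloor : ℕ → ℕ → ℕ → Set
IsFloor s n a =
  ((2 * a + n * s) * (2 * a + n * s) ≤ n * n * disc s) ×
  (n * n * disc s < (2 * suc a + n * s) * (2 * suc a + n * s))

IsFloorα⇒IsFloor : ∀ s n a → IsFloorα (2 + s) n a → IsFloor s n a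
IsFloorα⇒IsFloor s n a (lower , upper) =
  subst₂ _≤_ (square (2 * a + n * s)) disc≡ lower ,
  subst₂ _<_ disc≡ (trans (cong (λ z → (2 * z + n * s) ^ 2) (+-comm a 1)) (square (2 * suc a + n * s))) upper
  where
  square : ∀ x → x ^ 2 ≡ x * x
  square x = cong (x *_) (*-identityʳ x)
  disc≡ : n ^ 2 * ((2 + s) ^ 2 + 4) ≡ n * n * disc s
  disc≡ = cong₂ (λ u v → u * (v + 4)) (square n) (square (2 + s))

-- Since β² + tβ = 1, K < nβ iff βform s K n < n * n.
βform : ℕ → ℕ → ℕ → ℕ
βform s K n = K * K + K * n * (2 + s)

private
  expand-[2K+nt]² : ∀ s K n → (2 * K + n * (2 + s)) * (2 * K + n * (2 + s))
                            ≡ 4 * (K * K + K * n * (2 + s)) + n * n * ((2 + s) * (2 + s))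
  expand-[2K+nt]² = solve-∀

  expand-n²disc : ∀ s n → n * n * ((2 + s) * (2 + s) + 4) ≡ 4 * (n * n) + n * n * ((2 + s) * (2 + s))
  expand-n²disc = solve-∀

  expand-K²disc : ∀ s K n → K * K * ((2 + s) * (2 + s) + 4) + 4 * (K * n * (2 + s))
                            ≡ 4 * (K * K + K * n * (2 + s)) + (2 + s) * (2 + s) * (K * K)
  expand-K²disc = solve-∀

[2K+nt]²≤n²disc⇒βform≤n² : ∀ s K n → (2 * K + n * (2 + s)) * (2 * K + n * (2 + s)) ≤ n * n * disc s →
                           βform s K n ≤ n * n
[2K+nt]²≤n²disc⇒βform≤n² s K n h =
  *-cancelˡ-≤ 4 (+-cancelʳ-≤ _ _ _ (subst₂ _≤_ (expand-[2K+nt]² s K n) (expand-n²disc s n) h))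

n²disc<[2K+nt]²⇒n²<βform : ∀ s K n → n * n * disc s < (2 * K + n * (2 + s)) * (2 * K + n * (2 + s)) →
                           n * n < βform s K n
n²disc<[2K+nt]²⇒n²<βform s K n h =
  *-cancelˡ-< 4 _ _ (+-cancelʳ-< _ _ _ (subst₂ _<_ (expand-n²disc s n) (expand-[2K+nt]² s K n) h))

-- Here Y = 2n − tK, so that K²(t² + 4) < Y² says n > K(t + √(t² + 4))/2 = K/β.
module _ (s K n Y : ℕ) (Y+tK≡2n : Y + (2 + s) * K ≡ 2 * n) where
  private
    expand-Y² : Y * Y + 4 * (K * n * (2 + s)) ≡ 4 * (n * n) + (2 + s) * (2 + s) * (K * K)
    expand-Y² = begin
      Y * Y + 4 * (K * n * (2 + s))               ≡⟨ cong (Y * Y +_) (regroup s K n) ⟩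
      Y * Y + 2 * (2 * n) * K * (2 + s)           ≡⟨ cong (λ z → Y * Y + 2 * z * K * (2 + s)) (sym Y+tK≡2n) ⟩
      Y * Y + 2 * (Y + (2 + s) * K) * K * (2 + s) ≡⟨ complete-square s K Y ⟩
      (Y + (2 + s) * K) * (Y + (2 + s) * K) + (2 + s) * (2 + s) * (K * K)
        ≡⟨ cong (λ z → z * z + (2 + s) * (2 + s) * (K * K)) Y+tK≡2n ⟩
      (2 * n) * (2 * n) + (2 + s) * (2 + s) * (K * K) ≡⟨ cong (_+ (2 + s) * (2 + s) * (K * K)) ([2n]²≡4n² n) ⟩
      4 * (n * n) + (2 + s) * (2 + s) * (K * K)   ∎
      where
      open ≡-Reasoning
      regroup : ∀ s K n → 4 * (K * n * (2 + s)) ≡ 2 * (2 * n) * K * (2 + s)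
      regroup = solve-∀
      complete-square : ∀ s K Y → Y * Y + 2 * (Y + (2 + s) * K) * K * (2 + s)
                                  ≡ (Y + (2 + s) * K) * (Y + (2 + s) * K) + (2 + s) * (2 + s) * (K * K)
      complete-square = solve-∀
      [2n]²≡4n² : ∀ n → (2 * n) * (2 * n) ≡ 4 * (n * n)
      [2n]²≡4n² = solve-∀

  K²disc<Y²⇒βform<n² : K * K * disc s < Y * Y → βform s K n < n * n
  K²disc<Y²⇒βform<n² h = *-cancelˡ-< 4 _ _ (+-cancelʳ-< _ _ _
    (subst₂ _<_ (expand-K²disc s K n) expand-Y² (+-monoˡ-< (4 * (K * n * (2 + s))) h)))

  βform<n²⇒K²disc<Y² : βform s K n < n * n → K * K * disc s < Y * Y
  βform<n²⇒K²disc<Y² h = +-cancelʳ-< (4 * (K * n * (2 + s))) _ _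
    (subst₂ _<_ (sym (expand-K²disc s K n)) (sym expand-Y²) (+-monoˡ-< ((2 + s) * (2 + s) * (K * K)) (*-monoʳ-< 4 h)))

-- The descent (K, n) ↦ (n − tK, K) is one step of the continued fraction β = [0; t, t, …].
βform-descent : ∀ s K n → 1 ≤ K → βform s K n ≡ n * n →
                ∃[ K' ] (1 ≤ K' × K' < K × βform s K' K ≡ K * K)
βform-descent s K n 1≤K eq = K' , 1≤K' , K'<K , eq'
  where
  t = 2 + s
  tK<n : t * K < n
  tK<n with t * K <? n
  ... | yes p = p
  ... | no np = ⊥-elim (<-irrefl (sym eq) (begin-strict
    n * n                 ≤⟨ *-monoʳ-≤ n (≮⇒≥ np) ⟩
    n * (t * K)           ≡⟨ solve-n[tK] s K n ⟩
    K * n * t             <⟨ +-monoˡ-< (K * n * t) (*-mono-≤ 1≤K 1≤K) ⟩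
    K * K + K * n * t     ∎))
    where
    open ≤-Reasoning
    solve-n[tK] : ∀ s K n → n * ((2 + s) * K) ≡ K * n * (2 + s)
    solve-n[tK] = solve-∀
  K' = n ∸ t * K
  tK+K'≡n : t * K + K' ≡ n
  tK+K'≡n = m+[n∸m]≡n (<⇒≤ tK<n)
  eq' : βform s K' K ≡ K * K
  eq' = sym (+-cancelʳ-≡ _ _ _ (begin
    K * K + (t * t * (K * K) + K' * K * t)  ≡⟨ expand-lhs s K K' ⟩
    K * K + K * (t * K + K') * t            ≡⟨ subst (λ z → K * K + K * z * t ≡ z * z) (sym tK+K'≡n) eq ⟩
    (t * K + K') * (t * K + K')             ≡⟨ expand-rhs s K K' ⟩
    βform s K' K + (t * t * (K * K) + K' * K * t) ∎))
    where
    open ≡-Reasoning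
    expand-lhs : ∀ s K K' → K * K + ((2 + s) * (2 + s) * (K * K) + K' * K * (2 + s))
                          ≡ K * K + K * ((2 + s) * K + K') * (2 + s)
    expand-lhs = solve-∀
    expand-rhs : ∀ s K K' → ((2 + s) * K + K') * ((2 + s) * K + K')
                          ≡ (K' * K' + K' * K * (2 + s)) + ((2 + s) * (2 + s) * (K * K) + K' * K * (2 + s))
    expand-rhs = solve-∀
  1≤K' : 1 ≤ K'
  1≤K' = positive K' eq'
    where
    positive : ∀ k → βform s k K ≡ K * K → 1 ≤ k
    positive zero e = ⊥-elim (<-irrefl e (*-mono-≤ 1≤K 1≤K))
    positive (suc _) _ = s≤s z≤n
  K'<K : K' < K
  K'<K with K' <? K
  ... | yes p = p
  ... | no np = ⊥-elim (<-irrefl (sym eq') (≤-<-trans (*-mono-≤ (≮⇒≥ np) (≮⇒≥ np))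
                  (m<m+n (K' * K') (*-mono-≤ (*-mono-≤ 1≤K' 1≤K) (s≤s (z≤n {suc s}))))))

βform≢n² : ∀ s K n → 1 ≤ K → βform s K n ≢ n * n
βform≢n² s = <-rec (λ K → ∀ n → 1 ≤ K → βform s K n ≢ n * n) descend
  where
  descend : ∀ K → (∀ {K'} → K' < K → ∀ n → 1 ≤ K' → βform s K' n ≢ n * n) →
            ∀ n → 1 ≤ K → βform s K n ≢ n * n
  descend K ih n 1≤K eq with βform-descent s K n 1≤K eq
  ... | K' , 1≤K' , K'<K , eq' = ih K'<K K 1≤K' eq'

IsFloor⇒n≤a : ∀ s n a → IsFloor s n a → n ≤ a
IsFloor⇒n≤a s n a (_ , upper) with n ≤? a
... | yes n≤a = n≤a
... | no n≰a = ⊥-elim (<⇒≱ upper (begin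
  (2 * suc a + n * s) * (2 * suc a + n * s) ≤⟨ *-mono-≤ [2+2a+ns]≤nt [2+2a+ns]≤nt ⟩
  n * (2 + s) * (n * (2 + s))               ≤⟨ m≤m+n _ _ ⟩
  n * (2 + s) * (n * (2 + s)) + 4 * (n * n) ≡⟨ expand-[nt]²+4n² s n ⟩
  n * n * disc s                            ∎))
  where
  open ≤-Reasoning
  expand-nt : ∀ s n → 2 * n + n * s ≡ n * (2 + s)
  expand-nt = solve-∀
  expand-[nt]²+4n² : ∀ s n → n * (2 + s) * (n * (2 + s)) + 4 * (n * n) ≡ n * n * ((2 + s) * (2 + s) + 4)
  expand-[nt]²+4n² = solve-∀
  [2+2a+ns]≤nt : 2 * suc a + n * s ≤ n * (2 + s)
  [2+2a+ns]≤nt = ≤-trans (+-monoˡ-≤ (n * s) (*-monoʳ-≤ 2 (≰⇒> n≰a))) (≤-reflexive (expand-nt s n))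

-- For K ≥ 1: n + K ≤ ⌊nα⌋ iff K < nβ iff n > K/β = tK + Kβ iff n + K > tK + ⌊Kα⌋.
module FloorBounds (s n K a b : ℕ) where
  private
    t = 2 + s
    expand-2[n+K] : ∀ s n K → 2 * K + n * (2 + s) ≡ 2 * (n + K) + n * s
    expand-2[n+K] = solve-∀

  tK+b+1≤n+K⇒n+K≤a : IsFloor s n a → IsFloor s K b → t * K + b + 1 ≤ n + K → n + K ≤ a
  tK+b+1≤n+K⇒n+K≤a (_ , a-upper) (_ , b-upper) h with n + K ≤? a
  ... | yes p = p
  ... | no n+K≰a = ⊥-elim (<-asym βform<n² n²<βform)
    where
    n²<βform : n * n < βform s K n
    n²<βform = n²disc<[2K+nt]²⇒n²<βform s K n (<-≤-trans a-upper (*-mono-≤ ≤[2K+nt] ≤[2K+nt]))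
      where
      ≤[2K+nt] : 2 * suc a + n * s ≤ 2 * K + n * t
      ≤[2K+nt] = subst (2 * suc a + n * s ≤_) (sym (expand-2[n+K] s n K))
                   (+-monoˡ-≤ (n * s) (*-monoʳ-≤ 2 (≰⇒> n+K≰a)))
    Z = 2 * suc b + K * s
    Z+tK≤2n : Z + t * K ≤ 2 * n
    Z+tK≤2n = +-cancelʳ-≤ (2 * K) _ _ (subst₂ _≤_ (expand-lhs s K b) (expand-rhs n K) (*-monoʳ-≤ 2 h))
      where
      expand-lhs : ∀ s K b → 2 * ((2 + s) * K + b + 1) ≡ ((2 * (1 + b) + K * s) + (2 + s) * K) + 2 * K
      expand-lhs = solve-∀
      expand-rhs : ∀ n K → 2 * (n + K) ≡ 2 * n + 2 * K
      expand-rhs = solve-∀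
    Y = 2 * n ∸ t * K
    Y+tK≡2n : Y + t * K ≡ 2 * n
    Y+tK≡2n = m∸n+n≡m (≤-trans (m≤n+m (t * K) Z) Z+tK≤2n)
    βform<n² : βform s K n < n * n
    βform<n² = K²disc<Y²⇒βform<n² s K n Y Y+tK≡2n (<-≤-trans b-upper (*-mono-≤ Z≤Y Z≤Y))
      where
      Z≤Y : Z ≤ Y
      Z≤Y = +-cancelʳ-≤ (t * K) _ _ (subst (Z + t * K ≤_) (sym Y+tK≡2n) Z+tK≤2n)

  n+K≤a⇒tK+b+1≤n+K : IsFloor s n a → IsFloor s K b → 1 ≤ K → n + K ≤ a → t * K + b + 1 ≤ n + K
  n+K≤a⇒tK+b+1≤n+K (a-lower , _) (b-lower , _) 1≤K h with t * K + b + 1 ≤? n + K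
  ... | yes p = p
  ... | no np = ⊥-elim (<⇒≱ (βform<n²⇒K²disc<Y² s K n Y Y+tK≡2n βform<n²)
                            (≤-trans (*-mono-≤ Y≤2b+Ks Y≤2b+Ks) b-lower))
    where
    βform<n² : βform s K n < n * n
    βform<n² = ≤∧≢⇒< (([2K+nt]²≤n²disc⇒βform≤n² s K n (≤-trans (*-mono-≤ [2K+nt]≤ [2K+nt]≤) a-lower)))
                     (βform≢n² s K n 1≤K)
      where
      [2K+nt]≤ : 2 * K + n * t ≤ 2 * a + n * s
      [2K+nt]≤ = subst (_≤ 2 * a + n * s) (sym (expand-2[n+K] s n K)) (+-monoˡ-≤ (n * s) (*-monoʳ-≤ 2 h))
    tK<n : t * K < n
    tK<n with t * K <? n
    ... | yes p = p
    ... | no tK≮n = ⊥-elim (<⇒≱ βform<n² (begin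
      n * n         ≤⟨ *-monoʳ-≤ n (≮⇒≥ tK≮n) ⟩
      n * (t * K)   ≡⟨ solve-n[tK] s K n ⟩
      K * n * t     ≤⟨ m≤n+m _ _ ⟩
      βform s K n   ∎))
      where
      open ≤-Reasoning
      solve-n[tK] : ∀ s K n → n * ((2 + s) * K) ≡ K * n * (2 + s)
      solve-n[tK] = solve-∀
    Y = 2 * n ∸ t * K
    Y+tK≡2n : Y + t * K ≡ 2 * n
    Y+tK≡2n = m∸n+n≡m (≤-trans (<⇒≤ tK<n) (m≤m+n n (n + 0)))
    Y≤2b+Ks : Y ≤ 2 * b + K * s
    Y≤2b+Ks = +-cancelʳ-≤ (t * K) _ _ (subst₂ _≤_ (sym Y+tK≡2n) (+-comm (t * K) _)
      (+-cancelʳ-≤ (2 * K) _ _ (subst₂ _≤_ (expand-lhs n K) (expand-rhs s K b) (*-monoʳ-≤ 2 n+K≤tK+b))))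
      where
      n+K≤tK+b : n + K ≤ t * K + b
      n+K≤tK+b = ≤-pred (subst (suc (n + K) ≤_) (+-comm (t * K + b) 1) (≰⇒> np))
      expand-lhs : ∀ n K → 2 * (n + K) ≡ 2 * n + 2 * K
      expand-lhs = solve-∀
      expand-rhs : ∀ s K b → 2 * ((2 + s) * K + b) ≡ ((2 + s) * K + (2 * b + K * s)) + 2 * K
      expand-rhs = solve-∀

open FloorBounds public

-- A counting function C with this self-similarity determines ⌊nα⌋ = n + C (n − 1).
module FloorRecurrence
  (s : ℕ) (A : ℕ → ℕ) (isFloor : ∀ n → 1 ≤ n → IsFloor s n (A n)) (C : ℕ → ℕ)
  (C⇒ : ∀ k m → suc k ≤ C m → (2 + s) * suc k + C k ≤ m)
  (C⇐ : ∀ k m → (2 + s) * suc k + C k ≤ m → suc k ≤ C m) where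

  private
    t = 2 + s
    isFloor-suc : ∀ n → IsFloor s (suc n) (A (suc n))
    isFloor-suc n = isFloor (suc n) (s≤s z≤n)
    rearrange₁ : ∀ x K c → x + (K + c) + 1 ≡ (x + c) + (K + 1)
    rearrange₁ = solve-∀
    rearrange₂ : ∀ m K → suc m + K ≡ m + (K + 1)
    rearrange₂ = solve-∀
    tK≤m⇒k<m : ∀ k m → t * suc k ≤ m → k < m
    tK≤m⇒k<m k m p = ≤-trans (m≤n*m (suc k) t) p

  private
    Below : ℕ → Set
    Below m = ∀ {m'} → m' < m → A (suc m') ≡ suc m' + C m'

    1+m+Cm≤A[1+m] : ∀ m → Below m → suc m + C m ≤ A (suc m)
    1+m+Cm≤A[1+m] m ih = bound (C m) refl
      where
      bound : ∀ c → C m ≡ c → suc m + c ≤ A (suc m)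
      bound zero _ = subst (_≤ A (suc m)) (sym (+-identityʳ _)) (IsFloor⇒n≤a s _ _ (isFloor-suc m))
      bound (suc k) Cm≡1+k =
        tK+b+1≤n+K⇒n+K≤a s (suc m) (suc k) _ _ (isFloor-suc m) (isFloor-suc k) (subst₂ _≤_
          (trans (sym (rearrange₁ (t * suc k) (suc k) (C k))) (cong (λ z → t * suc k + z + 1) (sym (ih k<m))))
          (sym (rearrange₂ m (suc k)))
          (+-monoˡ-≤ (suc k + 1) tK+Ck≤m))
        where
        tK+Ck≤m : t * suc k + C k ≤ m
        tK+Ck≤m = C⇒ k m (≤-reflexive (sym Cm≡1+k))
        k<m : k < m
        k<m = tK≤m⇒k<m k m (≤-trans (m≤m+n _ _) tK+Ck≤m)

    A[1+m]≤1+m+Cm : ∀ m → Below m → A (suc m) ≤ suc m + C m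
    A[1+m]≤1+m+Cm m ih with A (suc m) ≤? suc m + C m
    ... | yes p = p
    ... | no np = ⊥-elim (n≮n c (C⇐ c m tK+Cc≤m))
      where
      c = C m
      K = suc c
      tK+AK+1≤1+m+K : t * K + A K + 1 ≤ suc m + K
      tK+AK+1≤1+m+K = n+K≤a⇒tK+b+1≤n+K s (suc m) K _ _ (isFloor-suc m) (isFloor-suc c) (s≤s z≤n)
                        (subst (_≤ A (suc m)) (sym (+-suc (suc m) c)) (≰⇒> np))
      tK≤m : t * K ≤ m
      tK≤m = ≤-pred (subst (_≤ suc m) (+-comm (t * K) 1) (+-cancelʳ-≤ K (t * K + 1) (suc m) (begin
        t * K + 1 + K   ≡⟨ rearrange₃ (t * K) K ⟩
        t * K + K + 1   ≤⟨ +-monoˡ-≤ 1 (+-monoʳ-≤ (t * K) (IsFloor⇒n≤a s K _ (isFloor-suc c))) ⟩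
        t * K + A K + 1 ≤⟨ tK+AK+1≤1+m+K ⟩
        suc m + K       ∎)))
        where
        open ≤-Reasoning
        rearrange₃ : ∀ x K → x + 1 + K ≡ x + K + 1
        rearrange₃ = solve-∀
      tK+Cc≤m : t * K + C c ≤ m
      tK+Cc≤m = +-cancelʳ-≤ (K + 1) _ _ (subst₂ _≤_
        (trans (cong (λ z → t * K + z + 1) (ih (tK≤m⇒k<m c m tK≤m))) (rearrange₁ (t * K) K (C c)))
        (rearrange₂ m K)
        tK+AK+1≤1+m+K)

  A[1+m]≡1+m+Cm : ∀ m → A (suc m) ≡ suc m + C m
  A[1+m]≡1+m+Cm = <-rec (λ m → A (suc m) ≡ suc m + C m)
                        (λ m ih → ≤-antisym (A[1+m]≤1+m+Cm m ih) (1+m+Cm≤A[1+m] m ih))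

≤ᵇ-true : ∀ {m n} → m ≤ n → (m ≤ᵇ n) ≡ true
≤ᵇ-true p = Equivalence.to T-≡ (≤⇒≤ᵇ p)

≤ᵇ-false : ∀ {m n} → n < m → (m ≤ᵇ n) ≡ false
≤ᵇ-false {m} {n} n<m with m ≤ᵇ n | ≤ᵇ⇒≤ m n
... | false | _ = refl
... | true | m≤n = ⊥-elim (<⇒≱ n<m (m≤n _))

≡ᵇ-true : ∀ {m n} → m ≡ n → (m ≡ᵇ n) ≡ true
≡ᵇ-true {m} {n} p = Equivalence.to T-≡ (≡⇒≡ᵇ m n p)

≡ᵇ-false : ∀ {m n} → m ≢ n → (m ≡ᵇ n) ≡ false
≡ᵇ-false {m} {n} m≢n with m ≡ᵇ n | ≡ᵇ⇒≡ m n
... | false | _ = refl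
... | true | m≡n = ⊥-elim (m≢n (m≡n _))

-- Indexing with default 0, so that it is total.
at : List ℕ → ℕ → ℕ
at [] _ = 0
at (a ∷ w) zero = a
at (a ∷ w) (suc i) = at w i

at-++ˡ : ∀ u v i → i < length u → at (u ++ v) i ≡ at u i
at-++ˡ (a ∷ u) v zero p = refl
at-++ˡ (a ∷ u) v (suc i) (s≤s p) = at-++ˡ u v i p

take-length-++ : ∀ (u v : List ℕ) → take (length u) (u ++ v) ≡ u
take-length-++ [] v = refl
take-length-++ (a ∷ u) v = cong (a ∷_) (take-length-++ u v)

take-length+-++ : ∀ (u v : List ℕ) i → take (length u + i) (u ++ v) ≡ u ++ take i v
take-length+-++ [] v i = refl
take-length+-++ (a ∷ u) v i = cong (a ∷_) (take-length+-++ u v i)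

take-++ˡ : ∀ (u v : List ℕ) i → i ≤ length u → take i (u ++ v) ≡ take i u
take-++ˡ u v zero p = refl
take-++ˡ (a ∷ u) v (suc i) (s≤s p) = cong (a ∷_) (take-++ˡ u v i p)

drop-++ˡ : ∀ (u v : List ℕ) i → i ≤ length u → drop i (u ++ v) ≡ drop i u ++ v
drop-++ˡ u v zero p = refl
drop-++ˡ (a ∷ u) v (suc i) (s≤s p) = drop-++ˡ u v i p

++-prefix : ∀ (u v u' v' : List ℕ) → u ++ v ≡ u' ++ v' → length u ≤ length u' → ∃[ w ] (u' ≡ u ++ w)
++-prefix [] v u' v' e p = u' , refl
++-prefix (a ∷ u) v (b ∷ u') v' e (s≤s p) with ∷-injective e
... | refl , e' with ++-prefix u v u' v' e' p
...   | w , refl = w , refl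

All-++ : ∀ {P : ℕ → Set} (u v : List ℕ) → All P u → All P v → All P (u ++ v)
All-++ [] v pu pv = pv
All-++ (a ∷ u) v (p ∷ pu) pv = p ∷ All-++ u v pu pv

All-at : ∀ {P : ℕ → Set} (w : List ℕ) i → All P w → i < length w → P (at w i)
All-at (a ∷ w) zero (p ∷ ps) q = p
All-at (a ∷ w) (suc i) (p ∷ ps) (s≤s q) = All-at w i ps q

All-drop : ∀ {P : ℕ → Set} k (w : List ℕ) → All P w → All P (drop k w)
All-drop zero w ps = ps
All-drop (suc k) [] [] = []
All-drop (suc k) (a ∷ w) (p ∷ ps) = All-drop k w ps

applyUpTo-cong : ∀ {g h : ℕ → ℕ} n → (∀ i → g i ≡ h i) → applyUpTo g n ≡ applyUpTo h n
applyUpTo-cong zero e = refl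
applyUpTo-cong (suc n) e = cong₂ _∷_ (e 0) (applyUpTo-cong n (λ i → e (suc i)))

take-applyUpTo : ∀ (g : ℕ → ℕ) a b → a ≤ b → take a (applyUpTo g b) ≡ applyUpTo g a
take-applyUpTo g zero b p = refl
take-applyUpTo g (suc a) (suc b) (s≤s p) = cong (g 0 ∷_) (take-applyUpTo (λ i → g (suc i)) a b p)

drop-applyUpTo : ∀ (g : ℕ → ℕ) c r → drop c (applyUpTo g (c + r)) ≡ applyUpTo (λ i → g (c + i)) r
drop-applyUpTo g zero r = refl
drop-applyUpTo g (suc c) r = drop-applyUpTo (λ i → g (suc i)) c r

applyUpTo≡take : ∀ (g : ℕ → ℕ) (w : List ℕ) k → k ≤ length w → (∀ i → i < k → g i ≡ at w i) →
                 applyUpTo g k ≡ take k w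
applyUpTo≡take g w zero p e = refl
applyUpTo≡take g (a ∷ w) (suc k) (s≤s p) e =
  cong₂ _∷_ (e 0 (s≤s z≤n)) (applyUpTo≡take (λ i → g (suc i)) w k p (λ i q → e (suc i) (s≤s q)))

All-applyUpTo : ∀ {P : ℕ → Set} (g : ℕ → ℕ) n → (∀ i → P (g i)) → All P (applyUpTo g n)
All-applyUpTo g zero h = []
All-applyUpTo g (suc n) h = h 0 ∷ All-applyUpTo (λ i → g (suc i)) n (λ i → h (suc i))

blockSums : List ℕ → List ℕ → List ℕ
blockSums w [] = []
blockSums w (c ∷ cs) = sum (take c w) ∷ blockSums (drop c w) cs

blockSumsᶠ : (ℕ → ℕ) → List ℕ → List ℕ
blockSumsᶠ g [] = []
blockSumsᶠ g (c ∷ cs) = sum (applyUpTo g c) ∷ blockSumsᶠ (λ i → g (c + i)) cs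

blockSums-++ : ∀ (u u' cs cs' : List ℕ) → sum cs ≡ length u →
               blockSums (u ++ u') (cs ++ cs') ≡ blockSums u cs ++ blockSums u' cs'
blockSums-++ [] u' [] cs' e = refl
blockSums-++ (a ∷ u) u' [] cs' ()
blockSums-++ u u' (c ∷ cs) cs' e = cong₂ _∷_ (cong sum (take-++ˡ u u' c c≤|u|))
  (trans (cong (λ z → blockSums z (cs ++ cs')) (drop-++ˡ u u' c c≤|u|))
         (blockSums-++ (drop c u) u' cs cs' Σcs≡|drop|))
  where
  c≤|u| : c ≤ length u
  c≤|u| = ≤-trans (m≤m+n c (sum cs)) (≤-reflexive e)
  Σcs≡|drop| : sum cs ≡ length (drop c u)
  Σcs≡|drop| = trans (sym (m+n∸m≡n c (sum cs))) (trans (cong (_∸ c) e) (sym (length-drop c u)))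

blockSums-applyUpTo : ∀ (g : ℕ → ℕ) cs → blockSums (applyUpTo g (sum cs)) cs ≡ blockSumsᶠ g cs
blockSums-applyUpTo g [] = refl
blockSums-applyUpTo g (c ∷ cs) =
  cong₂ _∷_ (cong sum (take-applyUpTo g c (c + sum cs) (m≤m+n c (sum cs))))
            (trans (cong (λ z → blockSums z cs) (drop-applyUpTo g c (sum cs)))
                   (blockSums-applyUpTo (λ i → g (c + i)) cs))

blockSumsᶠ-cong : ∀ {g h : ℕ → ℕ} cs → (∀ i → g i ≡ h i) → blockSumsᶠ g cs ≡ blockSumsᶠ h cs
blockSumsᶠ-cong [] e = refl
blockSumsᶠ-cong (c ∷ cs) e = cong₂ _∷_ (cong sum (applyUpTo-cong c e)) (blockSumsᶠ-cong cs (λ i → e (c + i)))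

blockSums-replicate1 : ∀ k w cs → blockSums (rep k 1 ++ w) (rep k 1 ++ cs) ≡ rep k 1 ++ blockSums w cs
blockSums-replicate1 zero w cs = refl
blockSums-replicate1 (suc k) w cs = cong (1 ∷_) (blockSums-replicate1 k w cs)

-- A (A (i + 2)) − A (A (i + 1)) sums V over the positions A (i + 1) − 1, …, A (i + 2) − 2,
-- a block of length V i; these blocks cover ℕ in order because A 1 = 1.
module DifferenceBlocks (A V : ℕ → ℕ) (A1≡1 : A 1 ≡ 1) (A-step : ∀ j → A (2 + j) ≡ A (suc j) + V j) where
  open ≡-Reasoning

  private
    Δ : ℕ → ℕ
    Δ i = A (A (2 + i)) ∸ A (A (suc i))

    E : ℕ → ℕ
    E q = A (suc q) ∸ 1

    1≤A : ∀ q → 1 ≤ A (suc q)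
    1≤A zero = ≤-reflexive (sym A1≡1)
    1≤A (suc q) = ≤-trans (1≤A q) (≤-trans (m≤m+n _ (V q)) (≤-reflexive (sym (A-step q))))

    A≡1+E : ∀ q → A (suc q) ≡ suc (E q)
    A≡1+E q = sym (m+[n∸m]≡n (1≤A q))

    E-step : ∀ q → E (suc q) ≡ E q + V q
    E-step q = suc-injective (trans (sym (A≡1+E (suc q))) (trans (A-step q) (cong (_+ V q) (A≡1+E q))))

    A+ΣV : ∀ a L → A (suc a) + sum (applyUpTo (λ j → V (a + j)) L) ≡ A (suc (a + L))
    A+ΣV a zero = trans (+-identityʳ _) (cong (λ z → A (suc z)) (sym (+-identityʳ a)))
    A+ΣV a (suc L) = begin
      A (suc a) + (V (a + 0) + sum (applyUpTo (λ j → V (a + suc j)) L))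
        ≡⟨ sym (+-assoc (A (suc a)) _ _) ⟩
      (A (suc a) + V (a + 0)) + sum (applyUpTo (λ j → V (a + suc j)) L)
        ≡⟨ cong₂ _+_ (trans (cong (λ z → A (suc a) + V z) (+-identityʳ a)) (sym (A-step a)))
                     (cong sum (applyUpTo-cong L (λ j → cong V (+-suc a j)))) ⟩
      A (2 + a) + sum (applyUpTo (λ j → V (suc a + j)) L)
        ≡⟨ A+ΣV (suc a) L ⟩
      A (suc (suc a + L))
        ≡⟨ cong (λ z → A (suc z)) (sym (+-suc a L)) ⟩
      A (suc (a + suc L)) ∎

    blockSum≡Δ : ∀ q → sum (applyUpTo (λ j → V (E q + j)) (V q)) ≡ Δ q
    blockSum≡Δ q = begin
      X                                         ≡⟨ sym (m+n∸m≡n (A (A (suc q))) X) ⟩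
      (A (A (suc q)) + X) ∸ A (A (suc q))       ≡⟨ cong (λ z → (A z + X) ∸ A (A (suc q))) (A≡1+E q) ⟩
      (A (suc (E q)) + X) ∸ A (A (suc q))       ≡⟨ cong (_∸ A (A (suc q))) (A+ΣV (E q) (V q)) ⟩
      A (suc (E q) + V q) ∸ A (A (suc q))       ≡⟨ cong (λ z → A (z + V q) ∸ A (A (suc q))) (sym (A≡1+E q)) ⟩
      A (A (suc q) + V q) ∸ A (A (suc q))       ≡⟨ cong (λ z → A z ∸ A (A (suc q))) (sym (A-step q)) ⟩
      Δ q                                       ∎
      where
      X = sum (applyUpTo (λ j → V (E q + j)) (V q))

    blockSumsᶠ-from : ∀ P q → blockSumsᶠ (λ j → V (E q + j)) (applyUpTo (λ i → V (q + i)) P)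
                              ≡ applyUpTo (λ i → Δ (q + i)) P
    blockSumsᶠ-from zero q = refl
    blockSumsᶠ-from (suc P) q = cong₂ _∷_ head tail
      where
      head : sum (applyUpTo (λ j → V (E q + j)) (V (q + 0))) ≡ Δ (q + 0)
      head = subst (λ z → sum (applyUpTo (λ j → V (E q + j)) (V z)) ≡ Δ z) (sym (+-identityʳ q)) (blockSum≡Δ q)
      tail : blockSumsᶠ (λ i → V (E q + (V (q + 0) + i))) (applyUpTo (λ i → V (q + suc i)) P)
             ≡ applyUpTo (λ i → Δ (q + suc i)) P
      tail = begin
        blockSumsᶠ (λ i → V (E q + (V (q + 0) + i))) (applyUpTo (λ i → V (q + suc i)) P)
          ≡⟨ cong (blockSumsᶠ _) (applyUpTo-cong P (λ i → cong V (+-suc q i))) ⟩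
        blockSumsᶠ (λ i → V (E q + (V (q + 0) + i))) (applyUpTo (λ i → V (suc q + i)) P)
          ≡⟨ blockSumsᶠ-cong _ (λ i → cong V (shift i)) ⟩
        blockSumsᶠ (λ j → V (E (suc q) + j)) (applyUpTo (λ i → V (suc q + i)) P)
          ≡⟨ blockSumsᶠ-from P (suc q) ⟩
        applyUpTo (λ i → Δ (suc q + i)) P
          ≡⟨ applyUpTo-cong P (λ i → cong Δ (sym (+-suc q i))) ⟩
        applyUpTo (λ i → Δ (q + suc i)) P ∎
        where
        shift : ∀ i → E q + (V (q + 0) + i) ≡ E (suc q) + i
        shift i = trans (sym (+-assoc (E q) _ i))
                        (cong (_+ i) (trans (cong (λ z → E q + V z) (+-identityʳ q)) (sym (E-step q))))

  ΔAA≡blockSums : ∀ P → blockSumsᶠ V (applyUpTo V P) ≡ applyUpTo (ΔAA A) P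
  ΔAA≡blockSums P = begin
    blockSumsᶠ V (applyUpTo V P)                  ≡⟨ blockSumsᶠ-cong _ (λ j → cong (λ z → V (z + j)) (sym E0≡0)) ⟩
    blockSumsᶠ (λ j → V (E 0 + j)) (applyUpTo V P) ≡⟨ blockSumsᶠ-from P 0 ⟩
    applyUpTo Δ P                                  ≡⟨ applyUpTo-cong P (λ i → cong₂ (λ a b → A (A a) ∸ A (A b))
                                                        (+-comm 2 i) (+-comm 1 i)) ⟩
    applyUpTo (ΔAA A) P                            ∎
    where
    E0≡0 : E 0 ≡ 0
    E0≡0 = cong (_∸ 1) A1≡1

-- Admissible morphisms and their fixed points

InAlphabet : ℕ → ℕ → Set
InAlphabet t j = (1 ≤ j) × (j ≤ suc t)

-- The letters t and t + 1 are the large ones; ρ t (x i) will turn out to be A (i + 2) − A (i + 1).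
large : ℕ → ℕ → ℕ
large t j = if t ≤ᵇ j then 1 else 0

ρ : ℕ → ℕ → ℕ
ρ t j = suc (large t j)

-- The Sturmian morphism 1 ↦ 1^(t−1) 2, 2 ↦ 1^(t−1) 2 1 fixing the difference word of A.
φ : ℕ → ℕ → List ℕ
φ t c = rep (t ∸ 1) 1 ++ 2 ∷ rep (c ∸ 1) 1

-- ζ t (x 0) ζ t (x 1) ⋯ is again the difference word of A, now cut into blocks whose
-- i-th block has length |σ (x i)| + 1.
ζ : ℕ → ℕ → List ℕ
ζ t j = if t ≤ᵇ j then (if j ≡ᵇ t then 2 ∷ rep t 1 ++ [ 2 ] else 1 ∷ 2 ∷ rep (t ∸ 1) 1 ++ [ 2 ])
        else rep (t ∸ j) 1 ++ 2 ∷ rep j 1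

record LetterIdentities (t : ℕ) (σ d : ℕ → List ℕ) (j : ℕ) : Set where
  field
    σ-closed : All (InAlphabet t) (σ j)
    ρ∘σ≡φ∘ρ : map (ρ t) (σ j) ≡ φ t (ρ t j)
    ζ∘σ≡φ∘ζ : concatMap (ζ t) (σ j) ≡ concatMap (φ t) (ζ t j)
    d≡blockSums : d j ≡ blockSums (ζ t j) (map (ρ t) (σ j))
    length-ζ : length (ζ t j) ≡ t + ρ t j

record Admissible (t : ℕ) (σ d : ℕ → List ℕ) : Set where
  field
    σ1-tail : List ℕ
    σ1≡1∷tail : σ 1 ≡ 1 ∷ σ1-tail
    ζ1≡φ1∷ʳ1 : ζ t 1 ≡ φ t 1 ++ [ 1 ]
    letterwise : ∀ j → InAlphabet t j → LetterIdentities t σ d j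

sum-replicate1 : ∀ n → sum (rep n 1) ≡ n
sum-replicate1 zero = refl
sum-replicate1 (suc n) = cong suc (sum-replicate1 n)

sum-replicate0 : ∀ n → sum (rep n 0) ≡ 0
sum-replicate0 zero = refl
sum-replicate0 (suc n) = sum-replicate0 n

map-pred-replicate1 : ∀ n → map pred (rep n 1) ≡ rep n 0
map-pred-replicate1 zero = refl
map-pred-replicate1 (suc n) = cong (0 ∷_) (map-pred-replicate1 n)

sum-φ : ∀ t c → 1 ≤ t → sum (φ t (suc c)) ≡ t + suc c
sum-φ t c 1≤t = begin
  sum (rep (t ∸ 1) 1 ++ 2 ∷ rep c 1)       ≡⟨ sum-++ (rep (t ∸ 1) 1) _ ⟩
  sum (rep (t ∸ 1) 1) + (2 + sum (rep c 1)) ≡⟨ cong₂ (λ a b → a + (2 + b)) (sum-replicate1 (t ∸ 1)) (sum-replicate1 c) ⟩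
  (t ∸ 1) + suc (suc c)                    ≡⟨ +-suc (t ∸ 1) (suc c) ⟩
  suc (t ∸ 1) + suc c                      ≡⟨ cong (_+ suc c) (m+[n∸m]≡n 1≤t) ⟩
  t + suc c                                ∎
  where open ≡-Reasoning

sum-ρ : ∀ t w → sum (map (ρ t) w) ≡ length w + sum (map (large t) w)
sum-ρ t [] = refl
sum-ρ t (a ∷ w) = trans (cong (ρ t a +_) (sum-ρ t w)) (rearrange (large t a) (length w) (sum (map (large t) w)))
  where
  rearrange : ∀ a l s → suc a + (l + s) ≡ suc l + (a + s)
  rearrange = solve-∀

module FixedPoint (s : ℕ) {σ d : ℕ → List ℕ} (adm : Admissible (2 + s) σ d) where
  open Admissible adm

  t : ℕ
  t = 2 + s

  module _ (j : ℕ) (j∈ : InAlphabet t j) where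
    open LetterIdentities (letterwise j j∈) public

  Σρ∘σ≡length-ζ : ∀ j → InAlphabet t j → sum (map (ρ t) (σ j)) ≡ length (ζ t j)
  Σρ∘σ≡length-ζ j j∈ = trans (cong sum (ρ∘σ≡φ∘ρ j j∈)) (trans (sum-φ t (large t j) (s≤s z≤n)) (sym (length-ζ j j∈)))

  length-σ : ∀ j → InAlphabet t j → length (σ j) ≡ t + large t j
  length-σ j j∈ = begin
    length (σ j)                                   ≡⟨ sym (length-map (ρ t) (σ j)) ⟩
    length (map (ρ t) (σ j))                       ≡⟨ cong length (ρ∘σ≡φ∘ρ j j∈) ⟩
    length (rep (suc s) 1 ++ 2 ∷ rep (large t j) 1) ≡⟨ length-++ (rep (suc s) 1) ⟩
    length (rep (suc s) 1) + suc (length (rep (large t j) 1))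
      ≡⟨ cong₂ (λ a b → a + suc b) (length-replicate (suc s)) (length-replicate (large t j)) ⟩
    suc s + suc (large t j)                         ≡⟨ +-suc (suc s) (large t j) ⟩
    t + large t j                                   ∎
    where open ≡-Reasoning

  map-large-σ : ∀ j → InAlphabet t j → map (large t) (σ j) ≡ rep (suc s) 0 ++ 1 ∷ map pred (rep (large t j) 1)
  map-large-σ j j∈ = begin
    map (large t) (σ j)                                    ≡⟨ map-∘ (σ j) ⟩
    map pred (map (ρ t) (σ j))                             ≡⟨ cong (map pred) (ρ∘σ≡φ∘ρ j j∈) ⟩
    map pred (rep (suc s) 1 ++ 2 ∷ rep (large t j) 1)      ≡⟨ map-++ pred (rep (suc s) 1) _ ⟩
    map pred (rep (suc s) 1) ++ 1 ∷ map pred (rep (large t j) 1)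
      ≡⟨ cong (_++ 1 ∷ map pred (rep (large t j) 1)) (map-pred-replicate1 (suc s)) ⟩
    rep (suc s) 0 ++ 1 ∷ map pred (rep (large t j) 1)      ∎
    where open ≡-Reasoning

  Σlarge-σ≡1 : ∀ j → InAlphabet t j → sum (map (large t) (σ j)) ≡ 1
  Σlarge-σ≡1 j j∈ = begin
    sum (map (large t) (σ j))                                          ≡⟨ cong sum (map-large-σ j j∈) ⟩
    sum (rep (suc s) 0 ++ 1 ∷ map pred (rep (large t j) 1))            ≡⟨ sum-++ (rep (suc s) 0) _ ⟩
    sum (rep (suc s) 0) + suc (sum (map pred (rep (large t j) 1)))
      ≡⟨ cong₂ (λ a b → a + suc (sum b)) (sum-replicate0 (suc s)) (map-pred-replicate1 (large t j)) ⟩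
    suc (sum (rep (large t j) 0))                                      ≡⟨ cong suc (sum-replicate0 (large t j)) ⟩
    1                                                                  ∎
    where open ≡-Reasoning

  Σlarge-take-σ : ∀ j → InAlphabet t j →
                  sum (map (large t) (take (suc s) (σ j))) ≡ 0 × sum (map (large t) (take t (σ j))) ≡ 1
  Σlarge-take-σ j j∈ = before , upTo-t
    where
    open ≡-Reasoning
    Z = rep (suc s) 0
    R = 1 ∷ map pred (rep (large t j) 1)
    take-large : ∀ i → map (large t) (take i (σ j)) ≡ take i (Z ++ R)
    take-large i = trans (sym (take-map i (σ j))) (cong (take i) (map-large-σ j j∈))
    before : sum (map (large t) (take (suc s) (σ j))) ≡ 0
    before = begin
      sum (map (large t) (take (suc s) (σ j))) ≡⟨ cong sum (take-large (suc s)) ⟩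
      sum (take (suc s) (Z ++ R))              ≡⟨ cong (λ n → sum (take n (Z ++ R))) (sym (length-replicate (suc s))) ⟩
      sum (take (length Z) (Z ++ R))           ≡⟨ cong sum (take-length-++ Z R) ⟩
      sum Z                                    ≡⟨ sum-replicate0 (suc s) ⟩
      0                                        ∎
    upTo-t : sum (map (large t) (take t (σ j))) ≡ 1
    upTo-t = begin
      sum (map (large t) (take t (σ j)))   ≡⟨ cong sum (take-large t) ⟩
      sum (take t (Z ++ R))                ≡⟨ cong (λ n → sum (take n (Z ++ R))) (trans (cong suc (sym (length-replicate (suc s)))) (+-comm 1 _)) ⟩
      sum (take (length Z + 1) (Z ++ R))   ≡⟨ cong sum (take-length+-++ Z R 1) ⟩
      sum (Z ++ [ 1 ])                     ≡⟨ sum-++ Z [ 1 ] ⟩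
      sum Z + 1                            ≡⟨ cong (_+ 1) (sum-replicate0 (suc s)) ⟩
      1                                    ∎

  length-ζ≡1+length-σ : ∀ j → InAlphabet t j → length (ζ t j) ≡ suc (length (σ j))
  length-ζ≡1+length-σ j j∈ = begin
    length (ζ t j)                          ≡⟨ sym (Σρ∘σ≡length-ζ j j∈) ⟩
    sum (map (ρ t) (σ j))                   ≡⟨ sum-ρ t (σ j) ⟩
    length (σ j) + sum (map (large t) (σ j)) ≡⟨ cong (length (σ j) +_) (Σlarge-σ≡1 j j∈) ⟩
    length (σ j) + 1                        ≡⟨ +-comm (length (σ j)) 1 ⟩
    suc (length (σ j))                      ∎
    where open ≡-Reasoning

  All-concatMap-σ : ∀ w → All (InAlphabet t) w → All (InAlphabet t) (concatMap σ w)
  All-concatMap-σ [] [] = []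
  All-concatMap-σ (j ∷ w) (j∈ ∷ w∈) = All-++ (σ j) _ (σ-closed j j∈) (All-concatMap-σ w w∈)

  length-concatMap-σ : ∀ w → All (InAlphabet t) w →
                       length (concatMap σ w) ≡ t * length w + sum (map (large t) w)
  length-concatMap-σ [] [] = sym (trans (+-identityʳ _) (*-zeroʳ t))
  length-concatMap-σ (j ∷ w) (j∈ ∷ w∈) = begin
    length (σ j ++ concatMap σ w)                                 ≡⟨ length-++ (σ j) ⟩
    length (σ j) + length (concatMap σ w)                         ≡⟨ cong₂ _+_ (length-σ j j∈) (length-concatMap-σ w w∈) ⟩
    (t + large t j) + (t * length w + sum (map (large t) w))      ≡⟨ rearrange t (large t j) (length w) _ ⟩
    t * suc (length w) + (large t j + sum (map (large t) w))      ∎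
    where
    open ≡-Reasoning
    rearrange : ∀ t a l b → (t + a) + (t * l + b) ≡ t * suc l + (a + b)
    rearrange = solve-∀

  2|w|≤|σw| : ∀ w → All (InAlphabet t) w → length w + length w ≤ length (concatMap σ w)
  2|w|≤|σw| w w∈ = begin
    length w + length w                                ≤⟨ +-monoʳ-≤ (length w) (m≤m+n (length w) _) ⟩
    length w + (length w + s * length w)               ≤⟨ m≤m+n _ _ ⟩
    t * length w + sum (map (large t) w)               ≡⟨ sym (length-concatMap-σ w w∈) ⟩
    length (concatMap σ w)                             ∎
    where open ≤-Reasoning

  Σlarge-concatMap-σ : ∀ w → All (InAlphabet t) w → sum (map (large t) (concatMap σ w)) ≡ length w
  Σlarge-concatMap-σ [] [] = refl
  Σlarge-concatMap-σ (j ∷ w) (j∈ ∷ w∈) = begin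
    sum (map (large t) (σ j ++ concatMap σ w))                          ≡⟨ cong sum (map-++ (large t) (σ j) _) ⟩
    sum (map (large t) (σ j) ++ map (large t) (concatMap σ w))          ≡⟨ sum-++ (map (large t) (σ j)) _ ⟩
    sum (map (large t) (σ j)) + sum (map (large t) (concatMap σ w))     ≡⟨ cong₂ _+_ (Σlarge-σ≡1 j j∈) (Σlarge-concatMap-σ w w∈) ⟩
    suc (length w)                                                      ∎
    where open ≡-Reasoning

  iterate : ℕ → List ℕ
  iterate zero = [ 1 ]
  iterate (suc n) = concatMap σ (iterate n)

  All-iterate : ∀ n → All (InAlphabet t) (iterate n)
  All-iterate zero = (s≤s z≤n , s≤s z≤n) ∷ []
  All-iterate (suc n) = All-concatMap-σ (iterate n) (All-iterate n)

  iterate-extends : ∀ n → ∃[ v ] (iterate (suc n) ≡ iterate n ++ v)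
  iterate-extends zero = σ1-tail ++ [] , cong (_++ []) σ1≡1∷tail
  iterate-extends (suc n) with iterate-extends n
  ... | v , e = concatMap σ v , trans (cong (concatMap σ) e) (concatMap-++ σ (iterate n) v)

  iterate-prefix : ∀ n k → ∃[ v ] (iterate (k + n) ≡ iterate n ++ v)
  iterate-prefix n zero = [] , sym (++-identityʳ (iterate n))
  iterate-prefix n (suc k) with iterate-prefix n k | iterate-extends (k + n)
  ... | v , e | v' , e' = v ++ v' , trans e' (trans (cong (_++ v') e) (++-assoc (iterate n) v v'))

  n<|iterate| : ∀ n → n < length (iterate n)
  n<|iterate| zero = s≤s z≤n
  n<|iterate| (suc n) = begin-strict
    suc n                      <⟨ s≤s (n<|iterate| n) ⟩
    suc L                      ≤⟨ +-monoˡ-≤ L (≤-trans (s≤s z≤n) (n<|iterate| n)) ⟩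
    L + L                      ≤⟨ 2|w|≤|σw| (iterate n) (All-iterate n) ⟩
    length (iterate (suc n))   ∎
    where
    open ≤-Reasoning
    L = length (iterate n)

  x : ℕ → ℕ
  x i = at (iterate (suc i)) i

  x≡at-iterate : ∀ i n → i < length (iterate n) → x i ≡ at (iterate n) i
  x≡at-iterate i n p with iterate-prefix n (suc i) | iterate-prefix (suc i) n
  ... | v , e | v' , e' = begin
    at (iterate (suc i)) i        ≡⟨ sym (at-++ˡ (iterate (suc i)) v' i (<-trans (n<1+n i) (n<|iterate| (suc i)))) ⟩
    at (iterate (suc i) ++ v') i  ≡⟨ cong (λ z → at z i) (sym e') ⟩
    at (iterate (n + suc i)) i    ≡⟨ cong (λ z → at (iterate z) i) (+-comm n (suc i)) ⟩
    at (iterate (suc i + n)) i    ≡⟨ cong (λ z → at z i) e ⟩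
    at (iterate n ++ v) i         ≡⟨ at-++ˡ (iterate n) v i p ⟩
    at (iterate n) i              ∎
    where open ≡-Reasoning

  x∈ : ∀ i → InAlphabet t (x i)
  x∈ i = All-at (iterate (suc i)) i (All-iterate (suc i)) (<-trans (n<1+n i) (n<|iterate| (suc i)))

  All-pref-x : ∀ k → All (InAlphabet t) (pref x k)
  All-pref-x k = All-applyUpTo x k x∈

  pref-x≡take-iterate : ∀ k n → k ≤ length (iterate n) → pref x k ≡ take k (iterate n)
  pref-x≡take-iterate k n p = applyUpTo≡take x (iterate n) k p (λ i q → x≡at-iterate i n (<-≤-trans q p))

  pref-x-of-iterate : ∀ n u v → iterate n ≡ u ++ v → pref x (length u) ≡ u
  pref-x-of-iterate n u v e = begin
    pref x (length u)                  ≡⟨ pref-x≡take-iterate (length u) n |u|≤ ⟩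
    take (length u) (iterate n)        ≡⟨ cong (take (length u)) e ⟩
    take (length u) (u ++ v)           ≡⟨ take-length-++ u v ⟩
    u                                  ∎
    where
    open ≡-Reasoning
    |u|≤ : length u ≤ length (iterate n)
    |u|≤ = ≤-trans (m≤m+n (length u) (length v)) (≤-reflexive (sym (trans (cong length e) (length-++ u))))

  iterate≡pref-x++ : ∀ k n → k ≤ length (iterate n) → iterate n ≡ pref x k ++ drop k (iterate n)
  iterate≡pref-x++ k n p =
    trans (sym (take++drop≡id k (iterate n))) (cong (_++ drop k (iterate n)) (sym (pref-x≡take-iterate k n p)))

  σ-pref-x : ∀ k → pref x (length (concatMap σ (pref x k))) ≡ concatMap σ (pref x k)
  σ-pref-x k = pref-x-of-iterate (suc k) _ _
    (trans (cong (concatMap σ) (iterate≡pref-x++ k k (<⇒≤ (n<|iterate| k)))) (concatMap-++ σ (pref x k) _))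

  σ-pref-x-unbounded : ∀ N → ∃[ k ] (N ≤ length (concatMap σ (pref x k)))
  σ-pref-x-unbounded N = N , (begin
    N                                         ≤⟨ m≤m+n N N ⟩
    N + N                                     ≡⟨ cong₂ _+_ (sym (length-applyUpTo x N)) (sym (length-applyUpTo x N)) ⟩
    length (pref x N) + length (pref x N)     ≤⟨ 2|w|≤|σw| (pref x N) (All-pref-x N) ⟩
    length (concatMap σ (pref x N))           ∎)
    where open ≤-Reasoning

  ρ-concatMap-σ : ∀ w → All (InAlphabet t) w → map (ρ t) (concatMap σ w) ≡ concatMap (φ t) (map (ρ t) w)
  ρ-concatMap-σ [] [] = refl
  ρ-concatMap-σ (j ∷ w) (j∈ ∷ w∈) = trans (map-++ (ρ t) (σ j) _) (cong₂ _++_ (ρ∘σ≡φ∘ρ j j∈) (ρ-concatMap-σ w w∈))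

  ζ-concatMap-σ : ∀ w → All (InAlphabet t) w →
                  concatMap (ζ t) (concatMap σ w) ≡ concatMap (φ t) (concatMap (ζ t) w)
  ζ-concatMap-σ [] [] = refl
  ζ-concatMap-σ (j ∷ w) (j∈ ∷ w∈) = begin
    concatMap (ζ t) (σ j ++ concatMap σ w)                      ≡⟨ concatMap-++ (ζ t) (σ j) _ ⟩
    concatMap (ζ t) (σ j) ++ concatMap (ζ t) (concatMap σ w)    ≡⟨ cong₂ _++_ (ζ∘σ≡φ∘ζ j j∈) (ζ-concatMap-σ w w∈) ⟩
    concatMap (φ t) (ζ t j) ++ concatMap (φ t) (concatMap (ζ t) w) ≡⟨ sym (concatMap-++ (φ t) (ζ t j) _) ⟩
    concatMap (φ t) (ζ t j ++ concatMap (ζ t) w)               ∎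
    where open ≡-Reasoning

  -- Both sides are φⁿ (φ 1 ++ [ 1 ]).
  ζ-iterate : ∀ n → concatMap (ζ t) (iterate n) ≡ map (ρ t) (iterate (suc n)) ++ map (ρ t) (iterate n)
  ζ-iterate zero = begin
    ζ t 1 ++ []                                ≡⟨ ++-identityʳ _ ⟩
    ζ t 1                                      ≡⟨ ζ1≡φ1∷ʳ1 ⟩
    φ t 1 ++ [ 1 ]                             ≡⟨ cong (λ a → φ t a ++ [ a ]) (sym ρ1≡1) ⟩
    φ t (ρ t 1) ++ [ ρ t 1 ]                   ≡⟨ cong (_++ [ ρ t 1 ]) (sym (++-identityʳ (φ t (ρ t 1)))) ⟩
    concatMap (φ t) (map (ρ t) (iterate 0)) ++ map (ρ t) (iterate 0)
      ≡⟨ cong (_++ map (ρ t) (iterate 0)) (sym (ρ-concatMap-σ (iterate 0) (All-iterate 0))) ⟩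
    map (ρ t) (iterate 1) ++ map (ρ t) (iterate 0) ∎
    where
    open ≡-Reasoning
    ρ1≡1 : ρ t 1 ≡ 1
    ρ1≡1 = cong (λ b → suc (if b then 1 else 0)) (≤ᵇ-false {t} {1} (s≤s (s≤s z≤n)))
  ζ-iterate (suc n) = begin
    concatMap (ζ t) (concatMap σ (iterate n))                       ≡⟨ ζ-concatMap-σ (iterate n) (All-iterate n) ⟩
    concatMap (φ t) (concatMap (ζ t) (iterate n))                   ≡⟨ cong (concatMap (φ t)) (ζ-iterate n) ⟩
    concatMap (φ t) (map (ρ t) (iterate (suc n)) ++ map (ρ t) (iterate n))
      ≡⟨ concatMap-++ (φ t) (map (ρ t) (iterate (suc n))) (map (ρ t) (iterate n)) ⟩
    concatMap (φ t) (map (ρ t) (iterate (suc n))) ++ concatMap (φ t) (map (ρ t) (iterate n))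
      ≡⟨ sym (cong₂ _++_ (ρ-concatMap-σ (iterate (suc n)) (All-iterate (suc n))) (ρ-concatMap-σ (iterate n) (All-iterate n))) ⟩
    map (ρ t) (iterate (2 + n)) ++ map (ρ t) (iterate (suc n))      ∎
    where open ≡-Reasoning

  length-concatMap-ζ : ∀ w → All (InAlphabet t) w → length (concatMap (ζ t) w) ≡ length (concatMap σ w) + length w
  length-concatMap-ζ [] [] = refl
  length-concatMap-ζ (j ∷ w) (j∈ ∷ w∈) = begin
    length (ζ t j ++ concatMap (ζ t) w)                          ≡⟨ length-++ (ζ t j) ⟩
    length (ζ t j) + length (concatMap (ζ t) w)                  ≡⟨ cong₂ _+_ (length-ζ≡1+length-σ j j∈) (length-concatMap-ζ w w∈) ⟩
    suc (length (σ j)) + (length (concatMap σ w) + length w)     ≡⟨ rearrange (length (σ j)) (length (concatMap σ w)) (length w) ⟩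
    (length (σ j) + length (concatMap σ w)) + suc (length w)     ≡⟨ cong (_+ suc (length w)) (sym (length-++ (σ j))) ⟩
    length (σ j ++ concatMap σ w) + suc (length w)               ∎
    where
    open ≡-Reasoning
    rearrange : ∀ a b c → suc a + (b + c) ≡ (a + b) + suc c
    rearrange = solve-∀

  ζ-pref-x : ∀ k → concatMap (ζ t) (pref x k) ≡ map (ρ t) (pref x (length (concatMap (ζ t) (pref x k))))
  ζ-pref-x k = sym ρ-pref≡ζp
    where
    n = k + k
    p = pref x k
    v = drop k (iterate n)
    ζp = concatMap (ζ t) p
    M = length ζp
    iterate≡p++v : iterate n ≡ p ++ v
    iterate≡p++v = iterate≡pref-x++ k n (≤-trans (m≤m+n k k) (<⇒≤ (n<|iterate| n)))
    ζp++ζv≡ : ζp ++ concatMap (ζ t) v ≡ map (ρ t) (iterate (suc n)) ++ map (ρ t) (iterate n)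
    ζp++ζv≡ = trans (sym (concatMap-++ (ζ t) p v)) (trans (cong (concatMap (ζ t)) (sym iterate≡p++v)) (ζ-iterate n))
    k≤|v| : k ≤ length v
    k≤|v| = +-cancelˡ-≤ k k (length v) (begin
      k + k                   ≤⟨ <⇒≤ (n<|iterate| n) ⟩
      length (iterate n)      ≡⟨ cong length iterate≡p++v ⟩
      length (p ++ v)         ≡⟨ length-++ p ⟩
      length p + length v     ≡⟨ cong (_+ length v) (length-applyUpTo x k) ⟩
      k + length v            ∎)
      where open ≤-Reasoning
    M≤ : M ≤ length (iterate (suc n))
    M≤ = begin
      M                                                   ≡⟨ length-concatMap-ζ p (All-pref-x k) ⟩
      length (concatMap σ p) + length p                   ≡⟨ cong (length (concatMap σ p) +_) (length-applyUpTo x k) ⟩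
      length (concatMap σ p) + k                          ≤⟨ +-monoʳ-≤ (length (concatMap σ p)) (≤-trans k≤|v| (≤-trans (m≤m+n _ _)
                                                               (2|w|≤|σw| v (All-drop k (iterate n) (All-iterate n))))) ⟩
      length (concatMap σ p) + length (concatMap σ v)     ≡⟨ sym (length-++ (concatMap σ p)) ⟩
      length (concatMap σ p ++ concatMap σ v)             ≡⟨ cong length (sym (concatMap-++ σ p v)) ⟩
      length (concatMap σ (p ++ v))                       ≡⟨ cong (length ∘′ concatMap σ) (sym iterate≡p++v) ⟩
      length (iterate (suc n))                            ∎
      where open ≤-Reasoning
    ζp-prefix : ∃[ w ] (map (ρ t) (iterate (suc n)) ≡ ζp ++ w)
    ζp-prefix = ++-prefix ζp (concatMap (ζ t) v) (map (ρ t) (iterate (suc n))) (map (ρ t) (iterate n)) ζp++ζv≡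
                  (≤-trans M≤ (≤-reflexive (sym (length-map (ρ t) (iterate (suc n))))))
    ρ-pref≡ζp : map (ρ t) (pref x M) ≡ ζp
    ρ-pref≡ζp = begin
      map (ρ t) (pref x M)                   ≡⟨ cong (map (ρ t)) (pref-x≡take-iterate M (suc n) M≤) ⟩
      map (ρ t) (take M (iterate (suc n)))   ≡⟨ sym (take-map M (iterate (suc n))) ⟩
      take M (map (ρ t) (iterate (suc n)))   ≡⟨ cong (take M) (proj₂ ζp-prefix) ⟩
      take M (ζp ++ proj₁ ζp-prefix)         ≡⟨ take-length-++ ζp _ ⟩
      ζp                                     ∎
      where open ≡-Reasoning

  C : ℕ → ℕ
  C m = sum (map (large t) (pref x m))

  C-suc : ∀ m → C (suc m) ≡ C m + large t (x m)
  C-suc m = begin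
    sum (map (large t) (applyUpTo x (suc m)))             ≡⟨ cong (sum ∘′ map (large t)) (sym (applyUpTo-∷ʳ x m)) ⟩
    sum (map (large t) (applyUpTo x m ++ [ x m ]))        ≡⟨ cong sum (map-++ (large t) (applyUpTo x m) _) ⟩
    sum (map (large t) (applyUpTo x m) ++ [ large t (x m) ]) ≡⟨ sum-++ (map (large t) (applyUpTo x m)) _ ⟩
    C m + (large t (x m) + 0)                             ≡⟨ cong (C m +_) (+-identityʳ _) ⟩
    C m + large t (x m)                                   ∎
    where open ≡-Reasoning

  C-mono : ∀ {m m'} → m ≤ m' → C m ≤ C m'
  C-mono {m} {m'} m≤m' = subst (λ z → C m ≤ C z) (m∸n+n≡m m≤m') (C-mono+ (m' ∸ m))
    where
    C-mono+ : ∀ k → C m ≤ C (k + m)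
    C-mono+ zero = ≤-refl
    C-mono+ (suc k) = ≤-trans (C-mono+ k) (≤-trans (m≤m+n _ _) (≤-reflexive (sym (C-suc (k + m)))))

  P : ℕ → ℕ
  P k = length (concatMap σ (pref x k))

  P≡tk+Ck : ∀ k → P k ≡ t * k + C k
  P≡tk+Ck k = trans (length-concatMap-σ (pref x k) (All-pref-x k)) (cong (λ z → t * z + C k) (length-applyUpTo x k))

  pref-x-inside-block : ∀ k i → i ≤ length (σ (x k)) →
                        pref x (P k + i) ≡ concatMap σ (pref x k) ++ take i (σ (x k))
  pref-x-inside-block k i i≤ = begin
    pref x (P k + i)                                          ≡⟨ sym (take-applyUpTo x (P k + i) (P (suc k)) P+i≤) ⟩
    take (P k + i) (pref x (P (suc k)))                       ≡⟨ cong (take (P k + i)) (trans (σ-pref-x (suc k)) σ-pref-suc) ⟩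
    take (P k + i) (concatMap σ (pref x k) ++ σ (x k) ++ [])  ≡⟨ take-length+-++ (concatMap σ (pref x k)) _ i ⟩
    concatMap σ (pref x k) ++ take i (σ (x k) ++ [])          ≡⟨ cong (λ z → concatMap σ (pref x k) ++ take i z) (++-identityʳ (σ (x k))) ⟩
    concatMap σ (pref x k) ++ take i (σ (x k))                ∎
    where
    open ≡-Reasoning
    σ-pref-suc : concatMap σ (pref x (suc k)) ≡ concatMap σ (pref x k) ++ σ (x k) ++ []
    σ-pref-suc = trans (cong (concatMap σ) (sym (applyUpTo-∷ʳ x k))) (concatMap-++ σ (pref x k) [ x k ])
    P+i≤ : P k + i ≤ P (suc k)
    P+i≤ = ≤-trans (+-monoʳ-≤ (P k) i≤) (≤-reflexive (sym (trans (cong length σ-pref-suc)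
             (trans (length-++ (concatMap σ (pref x k))) (cong (P k +_) (trans (length-++ (σ (x k))) (+-identityʳ _)))))))

  C-inside-block : ∀ k i → i ≤ length (σ (x k)) → C (P k + i) ≡ k + sum (map (large t) (take i (σ (x k))))
  C-inside-block k i i≤ = begin
    sum (map (large t) (pref x (P k + i)))                               ≡⟨ cong (sum ∘′ map (large t)) (pref-x-inside-block k i i≤) ⟩
    sum (map (large t) (concatMap σ (pref x k) ++ take i (σ (x k))))     ≡⟨ cong sum (map-++ (large t) (concatMap σ (pref x k)) _) ⟩
    sum (map (large t) (concatMap σ (pref x k)) ++ map (large t) (take i (σ (x k))))
      ≡⟨ sum-++ (map (large t) (concatMap σ (pref x k))) _ ⟩
    sum (map (large t) (concatMap σ (pref x k))) + sum (map (large t) (take i (σ (x k))))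
      ≡⟨ cong (_+ sum (map (large t) (take i (σ (x k)))))
              (trans (Σlarge-concatMap-σ (pref x k) (All-pref-x k)) (length-applyUpTo x k)) ⟩
    k + sum (map (large t) (take i (σ (x k))))                           ∎
    where open ≡-Reasoning

  private
    t≤|σxk| : ∀ k → t ≤ length (σ (x k))
    t≤|σxk| k = ≤-trans (m≤m+n t _) (≤-reflexive (sym (length-σ (x k) (x∈ k))))

    t[1+k]+Ck≡Pk+t : ∀ k → t * suc k + C k ≡ P k + t
    t[1+k]+Ck≡Pk+t k = trans (rearrange t k (C k)) (cong (_+ t) (sym (P≡tk+Ck k)))
      where
      rearrange : ∀ t k c → t * suc k + c ≡ (t * k + c) + t
      rearrange = solve-∀

  -- The (k+1)-st large letter of x is the t-th letter of σ (x k), at position P k + t − 1.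
  C⇒ : ∀ k m → suc k ≤ C m → t * suc k + C k ≤ m
  C⇒ k m h with t * suc k + C k ≤? m
  ... | yes p = p
  ... | no np = ⊥-elim (<⇒≱ h (begin
    C m                   ≤⟨ C-mono m≤ ⟩
    C (P k + suc s)       ≡⟨ C-inside-block k (suc s) (≤-trans (n≤1+n _) (t≤|σxk| k)) ⟩
    k + sum (map (large t) (take (suc s) (σ (x k)))) ≡⟨ cong (k +_) (proj₁ (Σlarge-take-σ (x k) (x∈ k))) ⟩
    k + 0                 ≡⟨ +-identityʳ k ⟩
    k                     ∎))
    where
    open ≤-Reasoning
    m≤ : m ≤ P k + suc s
    m≤ = ≤-pred (≤-trans (≰⇒> np) (≤-reflexive (trans (t[1+k]+Ck≡Pk+t k) (+-suc (P k) (suc s)))))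

  C⇐ : ∀ k m → t * suc k + C k ≤ m → suc k ≤ C m
  C⇐ k m h = begin
    suc k                    ≡⟨ +-comm 1 k ⟩
    k + 1                    ≡⟨ cong (k +_) (sym (proj₂ (Σlarge-take-σ (x k) (x∈ k)))) ⟩
    k + sum (map (large t) (take t (σ (x k)))) ≡⟨ sym (C-inside-block k t (t≤|σxk| k)) ⟩
    C (P k + t)              ≤⟨ C-mono (≤-trans (≤-reflexive (sym (t[1+k]+Ck≡Pk+t k))) h) ⟩
    C m                      ∎
    where open ≤-Reasoning

  d-concatMap : ∀ w → All (InAlphabet t) w →
                concatMap d w ≡ blockSums (concatMap (ζ t) w) (map (ρ t) (concatMap σ w))
  d-concatMap [] [] = refl
  d-concatMap (j ∷ w) (j∈ ∷ w∈) = begin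
    d j ++ concatMap d w
      ≡⟨ cong₂ _++_ (d≡blockSums j j∈) (d-concatMap w w∈) ⟩
    blockSums (ζ t j) (map (ρ t) (σ j)) ++ blockSums (concatMap (ζ t) w) (map (ρ t) (concatMap σ w))
      ≡⟨ sym (blockSums-++ (ζ t j) _ (map (ρ t) (σ j)) _ (Σρ∘σ≡length-ζ j j∈)) ⟩
    blockSums (ζ t j ++ concatMap (ζ t) w) (map (ρ t) (σ j) ++ map (ρ t) (concatMap σ w))
      ≡⟨ cong (blockSums _) (sym (map-++ (ρ t) (σ j) _)) ⟩
    blockSums (ζ t j ++ concatMap (ζ t) w) (map (ρ t) (σ j ++ concatMap σ w)) ∎
    where open ≡-Reasoning

  Σρ-concatMap-σ : ∀ w → All (InAlphabet t) w → sum (map (ρ t) (concatMap σ w)) ≡ length (concatMap (ζ t) w)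
  Σρ-concatMap-σ [] [] = refl
  Σρ-concatMap-σ (j ∷ w) (j∈ ∷ w∈) = begin
    sum (map (ρ t) (σ j ++ concatMap σ w))                     ≡⟨ cong sum (map-++ (ρ t) (σ j) _) ⟩
    sum (map (ρ t) (σ j) ++ map (ρ t) (concatMap σ w))         ≡⟨ sum-++ (map (ρ t) (σ j)) _ ⟩
    sum (map (ρ t) (σ j)) + sum (map (ρ t) (concatMap σ w))    ≡⟨ cong₂ _+_ (Σρ∘σ≡length-ζ j j∈) (Σρ-concatMap-σ w w∈) ⟩
    length (ζ t j) + length (concatMap (ζ t) w)                ≡⟨ sym (length-++ (ζ t j)) ⟩
    length (ζ t j ++ concatMap (ζ t) w)                        ∎
    where open ≡-Reasoning

  module _ (A : ℕ → ℕ) (isFloorα : ∀ n → 1 ≤ n → IsFloorα t n (A n)) where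
    open FloorRecurrence s A (λ n 1≤n → IsFloorα⇒IsFloor s n (A n) (isFloorα n 1≤n)) C C⇒ C⇐

    V : ℕ → ℕ
    V i = ρ t (x i)

    A-step : ∀ j → A (2 + j) ≡ A (suc j) + V j
    A-step j = begin
      A (2 + j)                    ≡⟨ A[1+m]≡1+m+Cm (suc j) ⟩
      2 + j + C (suc j)            ≡⟨ cong (2 + j +_) (C-suc j) ⟩
      2 + j + (C j + large t (x j)) ≡⟨ rearrange j (C j) (large t (x j)) ⟩
      (suc j + C j) + V j          ≡⟨ cong (_+ V j) (sym (A[1+m]≡1+m+Cm j)) ⟩
      A (suc j) + V j              ∎
      where
      open ≡-Reasoning
      rearrange : ∀ j c l → 2 + j + (c + l) ≡ (suc j + c) + suc l
      rearrange = solve-∀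

    open DifferenceBlocks A V (A[1+m]≡1+m+Cm 0) A-step

    -- d (x 0 ⋯ x (k − 1)) = blockSums ΔA ΔA, since both ζ (x 0 ⋯) and ρ (σ (x 0 ⋯)) are prefixes of ΔA.
    d-pref-x : ∀ k → concatMap d (pref x k) ≡ applyUpTo (ΔAA A) (P k)
    d-pref-x k = begin
      concatMap d p                                          ≡⟨ d-concatMap p p∈ ⟩
      blockSums (concatMap (ζ t) p) (map (ρ t) (concatMap σ p)) ≡⟨ cong (λ z → blockSums z ρσp) (ζ-pref-x k) ⟩
      blockSums (map (ρ t) (pref x M)) ρσp                    ≡⟨ cong (λ z → blockSums z ρσp) (map-applyUpTo x (ρ t) M) ⟩
      blockSums (applyUpTo V M) ρσp                           ≡⟨ cong (λ z → blockSums (applyUpTo V z) ρσp) (sym (Σρ-concatMap-σ p p∈)) ⟩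
      blockSums (applyUpTo V (sum ρσp)) ρσp                   ≡⟨ blockSums-applyUpTo V ρσp ⟩
      blockSumsᶠ V ρσp                                        ≡⟨ cong (blockSumsᶠ V) (trans (cong (map (ρ t)) (sym (σ-pref-x k)))
                                                                  (map-applyUpTo x (ρ t) (P k))) ⟩
      blockSumsᶠ V (applyUpTo V (P k))                        ≡⟨ ΔAA≡blockSums (P k) ⟩
      applyUpTo (ΔAA A) (P k)                                 ∎
      where
      open ≡-Reasoning
      p = pref x k
      p∈ : All (InAlphabet t) p
      p∈ = All-pref-x k
      M = length (concatMap (ζ t) p)
      ρσp = map (ρ t) (concatMap σ p)

    length-d-pref-x : ∀ k → length (concatMap d (pref x k)) ≡ P k
    length-d-pref-x k = trans (cong length (d-pref-x k)) (length-applyUpTo (ΔAA A) (P k))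

    fixedPoint-decorates-ΔAA :
      ∃[ y ] ((∀ i → (1 ≤ y i) × (y i ≤ suc t)) × IsImage σ y y × IsImage d y (ΔAA A))
    fixedPoint-decorates-ΔAA =
      x , x∈ , (σ-pref-x , σ-pref-x-unbounded) ,
      (λ k → trans (cong (pref (ΔAA A)) (length-d-pref-x k)) (sym (d-pref-x k))) ,
      (λ N → let (k , N≤) = σ-pref-x-unbounded N in k , subst (N ≤_) (sym (length-d-pref-x k)) N≤)

-- The cases t = 2 and t = 3

letter : ∀ t j → {T (1 ≤ᵇ j)} → {T (j ≤ᵇ suc t)} → InAlphabet t j
letter t j {p} {q} = ≤ᵇ⇒≤ 1 j p , ≤ᵇ⇒≤ j (suc t) q

admissible-2 : Admissible 2 τ2 δ2
admissible-2 = record { σ1-tail = 2 ∷ [] ; σ1≡1∷tail = refl ; ζ1≡φ1∷ʳ1 = refl ; letterwise = letterwise }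
  where
  letterwise : ∀ j → InAlphabet 2 j → LetterIdentities 2 τ2 δ2 j
  letterwise 1 _ = record
    { σ-closed = letter 2 1 ∷ letter 2 2 ∷ []
    ; ρ∘σ≡φ∘ρ = refl ; ζ∘σ≡φ∘ζ = refl ; d≡blockSums = refl ; length-ζ = refl }
  letterwise 2 _ = record
    { σ-closed = letter 2 1 ∷ letter 2 3 ∷ letter 2 1 ∷ []
    ; ρ∘σ≡φ∘ρ = refl ; ζ∘σ≡φ∘ζ = refl ; d≡blockSums = refl ; length-ζ = refl }
  letterwise 3 _ = record
    { σ-closed = letter 2 1 ∷ letter 2 2 ∷ letter 2 1 ∷ []
    ; ρ∘σ≡φ∘ρ = refl ; ζ∘σ≡φ∘ζ = refl ; d≡blockSums = refl ; length-ζ = refl }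
  letterwise (suc (suc (suc (suc _)))) (_ , s≤s (s≤s (s≤s ())))

admissible-3 : Admissible 3 τ3 δ3
admissible-3 = record { σ1-tail = 2 ∷ 3 ∷ [] ; σ1≡1∷tail = refl ; ζ1≡φ1∷ʳ1 = refl ; letterwise = letterwise }
  where
  letterwise : ∀ j → InAlphabet 3 j → LetterIdentities 3 τ3 δ3 j
  letterwise 1 _ = record
    { σ-closed = letter 3 1 ∷ letter 3 2 ∷ letter 3 3 ∷ []
    ; ρ∘σ≡φ∘ρ = refl ; ζ∘σ≡φ∘ζ = refl ; d≡blockSums = refl ; length-ζ = refl }
  letterwise 2 _ = record
    { σ-closed = letter 3 1 ∷ letter 3 2 ∷ letter 3 4 ∷ []
    ; ρ∘σ≡φ∘ρ = refl ; ζ∘σ≡φ∘ζ = refl ; d≡blockSums = refl ; length-ζ = refl }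
  letterwise 3 _ = record
    { σ-closed = letter 3 1 ∷ letter 3 1 ∷ letter 3 4 ∷ letter 3 1 ∷ []
    ; ρ∘σ≡φ∘ρ = refl ; ζ∘σ≡φ∘ζ = refl ; d≡blockSums = refl ; length-ζ = refl }
  letterwise 4 _ = record
    { σ-closed = letter 3 1 ∷ letter 3 2 ∷ letter 3 4 ∷ letter 3 1 ∷ []
    ; ρ∘σ≡φ∘ρ = refl ; ζ∘σ≡φ∘ζ = refl ; d≡blockSums = refl ; length-ζ = refl }
  letterwise (suc (suc (suc (suc (suc _))))) (_ , s≤s (s≤s (s≤s (s≤s ()))))

-- The case t ≥ 4

replicate-++ : ∀ a b (c : ℕ) → rep a c ++ rep b c ≡ rep (a + b) c
replicate-++ zero b c = refl
replicate-++ (suc a) b c = cong (c ∷_) (replicate-++ a b c)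

replicate-∷ʳ : ∀ n (c : ℕ) → rep n c ++ [ c ] ≡ c ∷ rep n c
replicate-∷ʳ zero c = refl
replicate-∷ʳ (suc n) c = cong (c ∷_) (replicate-∷ʳ n c)

length-1ⁿ++ : ∀ n w → length (rep n 1 ++ w) ≡ n + length w
length-1ⁿ++ n w = trans (length-++ (rep n 1)) (cong (_+ length w) (length-replicate n))

φ1ⁿ : ℕ → ℕ → List ℕ
φ1ⁿ t zero = []
φ1ⁿ t (suc n) = φ t 1 ++ φ1ⁿ t n

φ1ⁿ-suc : ∀ t n → φ1ⁿ t n ++ φ t 1 ≡ φ1ⁿ t (suc n)
φ1ⁿ-suc t zero = sym (++-identityʳ (φ t 1))
φ1ⁿ-suc t (suc n) = trans (++-assoc (φ t 1) (φ1ⁿ t n) (φ t 1)) (cong (φ t 1 ++_) (φ1ⁿ-suc t n))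

φ1ⁿ-suc-++ : ∀ t n w → φ1ⁿ t n ++ (φ t 1 ++ w) ≡ φ1ⁿ t (suc n) ++ w
φ1ⁿ-suc-++ t n w = trans (sym (++-assoc (φ1ⁿ t n) (φ t 1) w)) (cong (_++ w) (φ1ⁿ-suc t n))

concatMap-φ-1ⁿ : ∀ t n → concatMap (φ t) (rep n 1) ≡ φ1ⁿ t n
concatMap-φ-1ⁿ t zero = refl
concatMap-φ-1ⁿ t (suc n) = cong (φ t 1 ++_) (concatMap-φ-1ⁿ t n)

concatMap-φ-1ⁿ++ : ∀ t n w → concatMap (φ t) (rep n 1 ++ w) ≡ φ1ⁿ t n ++ concatMap (φ t) w
concatMap-φ-1ⁿ++ t n w = trans (concatMap-++ (φ t) (rep n 1) w) (cong (_++ concatMap (φ t) w) (concatMap-φ-1ⁿ t n))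

run : ℕ → ℕ → List ℕ
run a n = applyUpTo (a +_) n

run-suc : ∀ a n → run a (suc n) ≡ a ∷ run (suc a) n
run-suc a n = cong₂ _∷_ (+-identityʳ a) (applyUpTo-cong n (λ i → +-suc a i))

All-run : ∀ t a n → 1 ≤ a → a + n ≤ 2 + t → All (InAlphabet t) (run a n)
All-run t a zero 1≤a a+n≤ = []
All-run t a (suc n) 1≤a a+n≤ = subst (All (InAlphabet t)) (sym (run-suc a n))
  ((1≤a , ≤-pred (≤-trans (s≤s (m≤m+n a n)) 1+a+n≤))
   ∷ All-run t (suc a) n (s≤s z≤n) 1+a+n≤)
  where
  1+a+n≤ : suc a + n ≤ 2 + t
  1+a+n≤ = ≤-trans (≤-reflexive (sym (+-suc a n))) a+n≤

ρ-small : ∀ t j → j < t → ρ t j ≡ 1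
ρ-small t j j<t = cong (λ b → suc (if b then 1 else 0)) (≤ᵇ-false j<t)

ρ-large : ∀ t j → t ≤ j → ρ t j ≡ 2
ρ-large t j t≤j = cong (λ b → suc (if b then 1 else 0)) (≤ᵇ-true t≤j)

ρ-run : ∀ t a n → a + n ≤ t → map (ρ t) (run a n) ≡ rep n 1
ρ-run t a zero a+n≤t = refl
ρ-run t a (suc n) a+n≤t = trans (cong (map (ρ t)) (run-suc a n))
  (cong₂ _∷_ (ρ-small t a (≤-trans (s≤s (m≤m+n a n)) 1+a+n≤t)) (ρ-run t (suc a) n 1+a+n≤t))
  where
  1+a+n≤t : suc a + n ≤ t
  1+a+n≤t = ≤-trans (≤-reflexive (sym (+-suc a n))) a+n≤t

ζ-small : ∀ t j → j < t → ζ t j ≡ rep (t ∸ j) 1 ++ 2 ∷ rep j 1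
ζ-small t j j<t rewrite ≤ᵇ-false {t} {j} j<t = refl

-- Consecutive ζ-blocks 1^(t−a) 2 1^a ⋅ 1^(t−a−1) 2 1^(a+1) ⋯ merge into powers of φ t 1 = 1^(t−1) 2.
ζ-run : ∀ t a n → 1 ≤ a → suc (a + n) ≤ t →
        concatMap (ζ t) (run a (suc n)) ≡ rep (t ∸ a) 1 ++ 2 ∷ (φ1ⁿ t n ++ rep (a + n) 1)
ζ-run t a zero 1≤a a<t = begin
  ζ t (a + 0) ++ []                          ≡⟨ ++-identityʳ _ ⟩
  ζ t (a + 0)                                ≡⟨ cong (ζ t) (+-identityʳ a) ⟩
  ζ t a                                      ≡⟨ ζ-small t a (≤-trans (s≤s (≤-reflexive (sym (+-identityʳ a)))) a<t) ⟩
  rep (t ∸ a) 1 ++ 2 ∷ rep a 1               ≡⟨ cong (λ z → rep (t ∸ a) 1 ++ 2 ∷ rep z 1) (sym (+-identityʳ a)) ⟩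
  rep (t ∸ a) 1 ++ 2 ∷ rep (a + 0) 1         ∎
  where open ≡-Reasoning
ζ-run t a (suc n) 1≤a a+n<t = begin
  concatMap (ζ t) (run a (2 + n))
    ≡⟨ cong (concatMap (ζ t)) (run-suc a (suc n)) ⟩
  ζ t a ++ concatMap (ζ t) (run (suc a) (suc n))
    ≡⟨ cong₂ _++_ (ζ-small t a a<t) (ζ-run t (suc a) n (s≤s z≤n) (≤-trans (≤-reflexive (cong suc (sym (+-suc a n)))) a+n<t)) ⟩
  (rep (t ∸ a) 1 ++ [ 2 ] ++ rep a 1) ++ (rep (t ∸ suc a) 1 ++ [ 2 ] ++ (φ1ⁿ t n ++ rep (suc a + n) 1))
    ≡⟨ reassociate (rep (t ∸ a) 1) [ 2 ] (rep a 1) (rep (t ∸ suc a) 1) (φ1ⁿ t n) (rep (suc a + n) 1) ⟩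
  rep (t ∸ a) 1 ++ [ 2 ] ++ ((rep a 1 ++ rep (t ∸ suc a) 1) ++ [ 2 ]) ++ (φ1ⁿ t n ++ rep (suc a + n) 1)
    ≡⟨ cong₂ (λ z w → rep (t ∸ a) 1 ++ [ 2 ] ++ (z ++ [ 2 ]) ++ (φ1ⁿ t n ++ rep w 1))
             (trans (replicate-++ a (t ∸ suc a) 1) (cong (λ z → rep z 1) (cong (_∸ 1) (m+[n∸m]≡n a<t))))
             (sym (+-suc a n)) ⟩
  rep (t ∸ a) 1 ++ [ 2 ] ++ φ t 1 ++ (φ1ⁿ t n ++ rep (a + suc n) 1)
    ≡⟨ cong (λ z → rep (t ∸ a) 1 ++ 2 ∷ z) (sym (++-assoc (φ t 1) (φ1ⁿ t n) _)) ⟩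
  rep (t ∸ a) 1 ++ 2 ∷ (φ1ⁿ t (suc n) ++ rep (a + suc n) 1) ∎
  where
  open ≡-Reasoning
  a<t : a < t
  a<t = ≤-trans (s≤s (m≤m+n a (suc n))) a+n<t
  reassociate : ∀ (A b B C D E : List ℕ) → (A ++ b ++ B) ++ (C ++ b ++ (D ++ E)) ≡ A ++ b ++ ((B ++ C) ++ b) ++ (D ++ E)
  reassociate A b B C D E = solve-monoid (++-monoid ℕ)

module SpecialLetters (s : ℕ) where
  private
    t : ℕ
    t = 4 + s
    ones₁ ones₂ : List ℕ
    ones₁ = rep (3 + s) 1
    ones₂ = rep (2 + s) 1
    Φ : List ℕ
    Φ = φ t 1

    1+t≢t : suc t ≢ t
    1+t≢t e = <-irrefl (sym e) (n<1+n t)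

    ρ-t : ρ t t ≡ 2
    ρ-t = ρ-large t t ≤-refl

    ρ-t+1 : ρ t (suc t) ≡ 2
    ρ-t+1 = ρ-large t (suc t) (n≤1+n t)

    ζ-t : ζ t t ≡ 2 ∷ rep t 1 ++ [ 2 ]
    ζ-t rewrite ≤ᵇ-true {t} {t} ≤-refl | ≡ᵇ-true {t} refl = refl

    ζ-t+1 : ζ t (suc t) ≡ 1 ∷ 2 ∷ ones₁ ++ [ 2 ]
    ζ-t+1 rewrite ≤ᵇ-true {t} {suc t} (n≤1+n t) | ≡ᵇ-false 1+t≢t = refl

    τ-1 : τgen t 1 ≡ run 1 (3 + s) ++ [ t ]
    τ-1 = trans (map-upTo (1 +_) t) (sym (applyUpTo-∷ʳ (1 +_) (3 + s)))

    τ-2 : τgen t 2 ≡ run 1 (3 + s) ++ [ suc t ]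
    τ-2 = cong₂ (λ a b → a ++ [ b ]) (map-upTo (1 +_) (3 + s)) (+-comm t 1)

    τ-t : τgen t t ≡ 1 ∷ run 1 (2 + s) ++ suc t ∷ 1 ∷ []
    τ-t rewrite ≡ᵇ-true {t} refl = cong₂ (λ a b → 1 ∷ a ++ b ∷ 1 ∷ []) (map-upTo (1 +_) (2 + s)) (+-comm t 1)

    τ-t+1 : τgen t (suc t) ≡ 1 ∷ 2 ∷ run 2 (1 + s) ++ suc t ∷ 1 ∷ []
    τ-t+1 rewrite ≡ᵇ-false 1+t≢t | ≡ᵇ-true {suc t} {t + 1} (+-comm 1 t) =
      cong₂ (λ a b → 1 ∷ 2 ∷ a ++ b ∷ 1 ∷ []) (map-upTo (2 +_) (1 + s)) (+-comm t 1)

    δ-t : δgen t t ≡ 2 ∷ ones₂ ++ 2 ∷ 2 ∷ []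
    δ-t rewrite ≡ᵇ-true {t} refl = refl

    δ-t+1 : δgen t (suc t) ≡ 1 ∷ 2 ∷ rep (1 + s) 1 ++ 2 ∷ 2 ∷ []
    δ-t+1 rewrite ≡ᵇ-false 1+t≢t | ≡ᵇ-true {suc t} {t + 1} (+-comm 1 t) = refl

    1∈ : InAlphabet t 1
    1∈ = s≤s z≤n , s≤s z≤n

  letter-1 : LetterIdentities t (τgen t) (δgen t) 1
  letter-1 = record
    { σ-closed = subst (All (InAlphabet t)) (sym τ-1)
                   (All-++ (run 1 (3 + s)) _ (All-run t 1 (3 + s) (s≤s z≤n) (m≤n+m t 2)) ((s≤s z≤n , n≤1+n t) ∷ []))
    ; ρ∘σ≡φ∘ρ = ρ∘τ
    ; ζ∘σ≡φ∘ζ = begin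
        concatMap (ζ t) (τgen t 1)                         ≡⟨ cong (concatMap (ζ t)) τ-1 ⟩
        concatMap (ζ t) (run 1 (3 + s) ++ [ t ])           ≡⟨ concatMap-++ (ζ t) (run 1 (3 + s)) [ t ] ⟩
        concatMap (ζ t) (run 1 (3 + s)) ++ ζ t t ++ []     ≡⟨ cong₂ (λ a b → a ++ b ++ []) (ζ-run t 1 (2 + s) (s≤s z≤n) ≤-refl) ζ-t ⟩
        (ones₁ ++ [ 2 ] ++ (φ1ⁿ t (2 + s) ++ ones₁)) ++ ([ 2 ] ++ [ 1 ] ++ ones₁ ++ [ 2 ]) ++ []
          ≡⟨ reassociate ones₁ (φ1ⁿ t (2 + s)) [ 2 ] [ 1 ] ⟩
        φ1ⁿ t (3 + s) ++ concatMap (φ t) (2 ∷ 1 ∷ [])       ≡⟨ sym (concatMap-φ-1ⁿ++ t (3 + s) (2 ∷ 1 ∷ [])) ⟩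
        concatMap (φ t) (ζ t 1)                            ∎
    ; d≡blockSums = sym (trans (cong (blockSums (ζ t 1)) ρ∘τ) (blockSums-replicate1 (3 + s) (2 ∷ 1 ∷ []) [ 2 ]))
    ; length-ζ = trans (length-1ⁿ++ (3 + s) _) (rearrange s)
    }
    where
    open ≡-Reasoning
    ρ∘τ : map (ρ t) (τgen t 1) ≡ φ t (ρ t 1)
    ρ∘τ = trans (cong (map (ρ t)) τ-1)
               (trans (map-++ (ρ t) (run 1 (3 + s)) _) (cong₂ (λ a b → a ++ [ b ]) (ρ-run t 1 (3 + s) ≤-refl) ρ-t))
    reassociate : ∀ (O P a b : List ℕ) → (O ++ a ++ (P ++ O)) ++ ((a ++ b ++ O ++ a) ++ [])
                                         ≡ ((O ++ a) ++ P) ++ ((O ++ a ++ b) ++ ((O ++ a) ++ []))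
    reassociate O P a b = solve-monoid (++-monoid ℕ)
    rearrange : ∀ s → 3 + s + 2 ≡ 4 + s + 1
    rearrange = solve-∀

  letter-2 : LetterIdentities t (τgen t) (δgen t) 2
  letter-2 = record
    { σ-closed = subst (All (InAlphabet t)) (sym τ-2)
                   (All-++ (run 1 (3 + s)) _ (All-run t 1 (3 + s) (s≤s z≤n) (m≤n+m t 2)) ((s≤s z≤n , ≤-refl) ∷ []))
    ; ρ∘σ≡φ∘ρ = ρ∘τ
    ; ζ∘σ≡φ∘ζ = begin
        concatMap (ζ t) (τgen t 2)                            ≡⟨ cong (concatMap (ζ t)) τ-2 ⟩
        concatMap (ζ t) (run 1 (3 + s) ++ [ suc t ])          ≡⟨ concatMap-++ (ζ t) (run 1 (3 + s)) [ suc t ] ⟩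
        concatMap (ζ t) (run 1 (3 + s)) ++ ζ t (suc t) ++ []  ≡⟨ cong₂ (λ a b → a ++ b ++ []) (ζ-run t 1 (2 + s) (s≤s z≤n) ≤-refl) ζ-t+1 ⟩
        (ones₁ ++ [ 2 ] ++ (φ1ⁿ t (2 + s) ++ ones₁)) ++ ([ 1 ] ++ [ 2 ] ++ ones₁ ++ [ 2 ]) ++ []
          ≡⟨ reassociate₁ ones₁ (φ1ⁿ t (2 + s)) [ 2 ] [ 1 ] ⟩
        φ1ⁿ t (3 + s) ++ ((ones₁ ++ [ 1 ]) ++ ([ 2 ] ++ Φ))
          ≡⟨ cong₂ (λ X Y → X ++ (Y ++ ([ 2 ] ++ Φ))) (sym (φ1ⁿ-suc t (2 + s))) (replicate-∷ʳ (3 + s) 1) ⟩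
        (φ1ⁿ t (2 + s) ++ Φ) ++ ((1 ∷ ones₁) ++ ([ 2 ] ++ Φ))
          ≡⟨ reassociate₂ ones₁ (φ1ⁿ t (2 + s)) [ 2 ] [ 1 ] ⟩
        φ1ⁿ t (2 + s) ++ concatMap (φ t) (2 ∷ 1 ∷ 1 ∷ [])      ≡⟨ sym (concatMap-φ-1ⁿ++ t (2 + s) (2 ∷ 1 ∷ 1 ∷ [])) ⟩
        concatMap (φ t) (ζ t 2)                               ∎
    ; d≡blockSums = sym (begin
        blockSums (ζ t 2) (map (ρ t) (τgen t 2))          ≡⟨ cong (blockSums (ζ t 2)) ρ∘τ ⟩
        blockSums (ζ t 2) (ones₁ ++ [ 2 ])                ≡⟨ cong (blockSums (ζ t 2)) ones₁2≡ones₂12 ⟩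
        blockSums (ζ t 2) (ones₂ ++ 1 ∷ 2 ∷ [])           ≡⟨ blockSums-replicate1 (2 + s) (2 ∷ 1 ∷ 1 ∷ []) (1 ∷ 2 ∷ []) ⟩
        δgen t 2                                          ∎)
    ; length-ζ = trans (length-1ⁿ++ (2 + s) _) (rearrange s)
    }
    where
    open ≡-Reasoning
    ρ∘τ : map (ρ t) (τgen t 2) ≡ φ t (ρ t 2)
    ρ∘τ = trans (cong (map (ρ t)) τ-2)
               (trans (map-++ (ρ t) (run 1 (3 + s)) _) (cong₂ (λ a b → a ++ [ b ]) (ρ-run t 1 (3 + s) ≤-refl) ρ-t+1))
    ones₁2≡ones₂12 : ones₁ ++ [ 2 ] ≡ ones₂ ++ 1 ∷ 2 ∷ []
    ones₁2≡ones₂12 = trans (cong (_++ [ 2 ]) (sym (replicate-∷ʳ (2 + s) 1))) (++-assoc ones₂ [ 1 ] [ 2 ])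
    reassociate₁ : ∀ (O P a b : List ℕ) → (O ++ a ++ (P ++ O)) ++ ((b ++ a ++ O ++ a) ++ [])
                                          ≡ ((O ++ a) ++ P) ++ ((O ++ b) ++ (a ++ (O ++ a)))
    reassociate₁ O P a b = solve-monoid (++-monoid ℕ)
    reassociate₂ : ∀ (O P a b : List ℕ) → (P ++ (O ++ a)) ++ ((b ++ O) ++ (a ++ (O ++ a)))
                                          ≡ P ++ ((O ++ a ++ b) ++ ((O ++ a) ++ ((O ++ a) ++ [])))
    reassociate₂ O P a b = solve-monoid (++-monoid ℕ)
    rearrange : ∀ s → 2 + s + 3 ≡ 4 + s + 1
    rearrange = solve-∀

  letter-t : LetterIdentities t (τgen t) (δgen t) t
  letter-t = record
    { σ-closed = subst (All (InAlphabet t)) (sym τ-t) (1∈ ∷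
                   All-++ (run 1 (2 + s)) _ (All-run t 1 (2 + s) (s≤s z≤n) (m≤n+m (3 + s) 3)) ((s≤s z≤n , ≤-refl) ∷ 1∈ ∷ []))
    ; ρ∘σ≡φ∘ρ = ρ∘τ
    ; ζ∘σ≡φ∘ζ = begin
        concatMap (ζ t) (τgen t t)
          ≡⟨ cong (concatMap (ζ t)) τ-t ⟩
        ζ t 1 ++ concatMap (ζ t) (run 1 (2 + s) ++ suc t ∷ 1 ∷ [])
          ≡⟨ cong (ζ t 1 ++_) (concatMap-++ (ζ t) (run 1 (2 + s)) (suc t ∷ 1 ∷ [])) ⟩
        ζ t 1 ++ (concatMap (ζ t) (run 1 (2 + s)) ++ ζ t (suc t) ++ ζ t 1 ++ [])
          ≡⟨ cong₂ (λ X Y → ζ t 1 ++ (X ++ Y ++ ζ t 1 ++ [])) (ζ-run t 1 (1 + s) (s≤s z≤n) (n≤1+n (3 + s))) ζ-t+1 ⟩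
        (ones₁ ++ [ 2 ] ++ [ 1 ]) ++ ((ones₁ ++ [ 2 ] ++ (φ1ⁿ t (1 + s) ++ ones₂))
          ++ (([ 1 ] ++ [ 2 ] ++ ones₁ ++ [ 2 ]) ++ ((ones₁ ++ [ 2 ] ++ [ 1 ]) ++ [])))
          ≡⟨ reassociate₁ ones₁ ones₂ (φ1ⁿ t (1 + s)) [ 2 ] [ 1 ] ⟩
        Φ ++ ([ 1 ] ++ (φ1ⁿ t (2 + s) ++ (((ones₂ ++ [ 1 ]) ++ [ 2 ]) ++ (Φ ++ (Φ ++ [ 1 ])))))
          ≡⟨ cong (λ z → Φ ++ ([ 1 ] ++ (φ1ⁿ t (2 + s) ++ ((z ++ [ 2 ]) ++ (Φ ++ (Φ ++ [ 1 ]))))))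
                  (replicate-∷ʳ (2 + s) 1) ⟩
        Φ ++ ([ 1 ] ++ (φ1ⁿ t (2 + s) ++ (Φ ++ (Φ ++ (Φ ++ [ 1 ])))))
          ≡⟨ cong (λ z → Φ ++ ([ 1 ] ++ z)) (trans (φ1ⁿ-suc-++ t (2 + s) _) (φ1ⁿ-suc-++ t (3 + s) _)) ⟩
        Φ ++ ([ 1 ] ++ (φ1ⁿ t t ++ (Φ ++ [ 1 ])))
          ≡⟨ reassociate₂ ones₁ (φ1ⁿ t t) [ 2 ] [ 1 ] ⟩
        φ t 2 ++ (φ1ⁿ t t ++ concatMap (φ t) [ 2 ])
          ≡⟨ cong (φ t 2 ++_) (sym (concatMap-φ-1ⁿ++ t t [ 2 ])) ⟩
        concatMap (φ t) (2 ∷ rep t 1 ++ [ 2 ])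
          ≡⟨ cong (concatMap (φ t)) (sym ζ-t) ⟩
        concatMap (φ t) (ζ t t) ∎
    ; d≡blockSums = sym (begin
        blockSums (ζ t t) (map (ρ t) (τgen t t))                       ≡⟨ cong₂ blockSums ζ-t (trans ρ∘τ (cong (φ t) ρ-t)) ⟩
        2 ∷ blockSums (rep t 1 ++ [ 2 ]) (ones₂ ++ 2 ∷ 1 ∷ [])         ≡⟨ cong (λ z → 2 ∷ blockSums z (ones₂ ++ 2 ∷ 1 ∷ [])) 1ᵗ2≡ ⟩
        2 ∷ blockSums (ones₂ ++ 1 ∷ 1 ∷ 2 ∷ []) (ones₂ ++ 2 ∷ 1 ∷ [])  ≡⟨ cong (2 ∷_) (blockSums-replicate1 (2 + s) _ _) ⟩
        2 ∷ ones₂ ++ 2 ∷ 2 ∷ []                                        ≡⟨ sym δ-t ⟩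
        δgen t t                                                      ∎)
    ; length-ζ = trans (cong length ζ-t) (trans (cong suc (length-1ⁿ++ t _)) (trans (rearrange s) (cong (t +_) (sym ρ-t))))
    }
    where
    open ≡-Reasoning
    ρ∘τ : map (ρ t) (τgen t t) ≡ φ t (ρ t t)
    ρ∘τ = trans (cong (map (ρ t)) τ-t) (trans (cong (1 ∷_) (map-++ (ρ t) (run 1 (2 + s)) _))
            (trans (cong₂ (λ a b → 1 ∷ a ++ b ∷ 1 ∷ []) (ρ-run t 1 (2 + s) (n≤1+n (3 + s))) ρ-t+1) (cong (φ t) (sym ρ-t))))
    1ᵗ2≡ : rep t 1 ++ [ 2 ] ≡ ones₂ ++ 1 ∷ 1 ∷ 2 ∷ []
    1ᵗ2≡ = trans (cong (_++ [ 2 ]) (sym (trans (replicate-++ (2 + s) 2 1) (cong (λ z → rep z 1) (+-comm (2 + s) 2)))))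
                 (++-assoc ones₂ (1 ∷ 1 ∷ []) [ 2 ])
    reassociate₁ : ∀ (O O' Q a b : List ℕ) →
      (O ++ a ++ b) ++ ((O ++ a ++ (Q ++ O')) ++ ((b ++ a ++ O ++ a) ++ ((O ++ a ++ b) ++ [])))
      ≡ (O ++ a) ++ (b ++ (((O ++ a) ++ Q) ++ (((O' ++ b) ++ a) ++ ((O ++ a) ++ ((O ++ a) ++ b)))))
    reassociate₁ O O' Q a b = solve-monoid (++-monoid ℕ)
    reassociate₂ : ∀ (O F a b : List ℕ) →
      (O ++ a) ++ (b ++ (F ++ ((O ++ a) ++ b))) ≡ (O ++ a ++ b) ++ (F ++ ((O ++ a ++ b) ++ []))
    reassociate₂ O F a b = solve-monoid (++-monoid ℕ)
    rearrange : ∀ s → suc (4 + s + 1) ≡ 4 + s + 2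
    rearrange = solve-∀

  letter-t+1 : LetterIdentities t (τgen t) (δgen t) (suc t)
  letter-t+1 = record
    { σ-closed = subst (All (InAlphabet t)) (sym τ-t+1) (1∈ ∷ (s≤s z≤n , s≤s (s≤s z≤n)) ∷
                   All-++ (run 2 (1 + s)) _ (All-run t 2 (1 + s) (s≤s z≤n) (m≤n+m (3 + s) 3)) ((s≤s z≤n , ≤-refl) ∷ 1∈ ∷ []))
    ; ρ∘σ≡φ∘ρ = ρ∘τ
    ; ζ∘σ≡φ∘ζ = begin
        concatMap (ζ t) (τgen t (suc t))
          ≡⟨ cong (concatMap (ζ t)) τ-t+1 ⟩
        ζ t 1 ++ ζ t 2 ++ concatMap (ζ t) (run 2 (1 + s) ++ suc t ∷ 1 ∷ [])
          ≡⟨ cong (λ z → ζ t 1 ++ ζ t 2 ++ z) (concatMap-++ (ζ t) (run 2 (1 + s)) (suc t ∷ 1 ∷ [])) ⟩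
        ζ t 1 ++ ζ t 2 ++ (concatMap (ζ t) (run 2 (1 + s)) ++ ζ t (suc t) ++ ζ t 1 ++ [])
          ≡⟨ cong₂ (λ X Y → ζ t 1 ++ ζ t 2 ++ (X ++ Y ++ ζ t 1 ++ [])) (ζ-run t 2 s (s≤s z≤n) (n≤1+n (3 + s))) ζ-t+1 ⟩
        (([ 1 ] ++ ones₂) ++ [ 2 ] ++ [ 1 ]) ++ ((ones₂ ++ [ 2 ] ++ [ 1 ] ++ [ 1 ])
          ++ ((ones₂ ++ [ 2 ] ++ (φ1ⁿ t s ++ ones₂))
          ++ (([ 1 ] ++ [ 2 ] ++ ([ 1 ] ++ ones₂) ++ [ 2 ]) ++ ((([ 1 ] ++ ones₂) ++ [ 2 ] ++ [ 1 ]) ++ []))))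
          ≡⟨ reassociate₁ ones₂ (φ1ⁿ t s) [ 2 ] [ 1 ] ⟩
        Φ ++ (Φ ++ ([ 1 ] ++ (φ1ⁿ t (1 + s) ++ (((ones₂ ++ [ 1 ]) ++ [ 2 ]) ++ (Φ ++ (Φ ++ [ 1 ]))))))
          ≡⟨ cong (λ z → Φ ++ (Φ ++ ([ 1 ] ++ (φ1ⁿ t (1 + s) ++ ((z ++ [ 2 ]) ++ (Φ ++ (Φ ++ [ 1 ])))))))
                  (replicate-∷ʳ (2 + s) 1) ⟩
        Φ ++ (Φ ++ ([ 1 ] ++ (φ1ⁿ t (1 + s) ++ (Φ ++ (Φ ++ (Φ ++ [ 1 ]))))))
          ≡⟨ cong (λ z → Φ ++ (Φ ++ ([ 1 ] ++ z))) (trans (φ1ⁿ-suc-++ t (1 + s) _) (φ1ⁿ-suc-++ t (2 + s) _)) ⟩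
        Φ ++ (Φ ++ ([ 1 ] ++ (φ1ⁿ t (3 + s) ++ (Φ ++ [ 1 ]))))
          ≡⟨ reassociate₂ ones₁ (φ1ⁿ t (3 + s)) [ 2 ] [ 1 ] ⟩
        φ t 1 ++ (φ t 2 ++ (φ1ⁿ t (3 + s) ++ concatMap (φ t) [ 2 ]))
          ≡⟨ cong (λ z → φ t 1 ++ (φ t 2 ++ z)) (sym (concatMap-φ-1ⁿ++ t (3 + s) [ 2 ])) ⟩
        concatMap (φ t) (1 ∷ 2 ∷ ones₁ ++ [ 2 ])
          ≡⟨ cong (concatMap (φ t)) (sym ζ-t+1) ⟩
        concatMap (φ t) (ζ t (suc t)) ∎
    ; d≡blockSums = sym (begin
        blockSums (ζ t (suc t)) (map (ρ t) (τgen t (suc t)))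
          ≡⟨ cong₂ blockSums ζ-t+1 (trans ρ∘τ (cong (φ t) ρ-t+1)) ⟩
        1 ∷ 2 ∷ blockSums (ones₁ ++ [ 2 ]) (rep (1 + s) 1 ++ 2 ∷ 1 ∷ [])
          ≡⟨ cong (λ z → 1 ∷ 2 ∷ blockSums z (rep (1 + s) 1 ++ 2 ∷ 1 ∷ [])) 1ᵗ⁻¹2≡ ⟩
        1 ∷ 2 ∷ blockSums (rep (1 + s) 1 ++ 1 ∷ 1 ∷ 2 ∷ []) (rep (1 + s) 1 ++ 2 ∷ 1 ∷ [])
          ≡⟨ cong (λ z → 1 ∷ 2 ∷ z) (blockSums-replicate1 (1 + s) _ _) ⟩
        1 ∷ 2 ∷ rep (1 + s) 1 ++ 2 ∷ 2 ∷ []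
          ≡⟨ sym δ-t+1 ⟩
        δgen t (suc t) ∎)
    ; length-ζ = trans (cong length ζ-t+1)
                   (trans (cong (λ z → suc (suc z)) (length-1ⁿ++ (3 + s) _)) (trans (rearrange s) (cong (t +_) (sym ρ-t+1))))
    }
    where
    open ≡-Reasoning
    ρ∘τ : map (ρ t) (τgen t (suc t)) ≡ φ t (ρ t (suc t))
    ρ∘τ = trans (cong (map (ρ t)) τ-t+1) (trans (cong (λ z → 1 ∷ 1 ∷ z) (map-++ (ρ t) (run 2 (1 + s)) _))
            (trans (cong₂ (λ a b → 1 ∷ 1 ∷ a ++ b ∷ 1 ∷ []) (ρ-run t 2 (1 + s) (n≤1+n (3 + s))) ρ-t+1) (cong (φ t) (sym ρ-t+1))))
    1ᵗ⁻¹2≡ : ones₁ ++ [ 2 ] ≡ rep (1 + s) 1 ++ 1 ∷ 1 ∷ 2 ∷ []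
    1ᵗ⁻¹2≡ = trans (cong (_++ [ 2 ]) (sym (trans (replicate-++ (1 + s) 2 1) (cong (λ z → rep z 1) (+-comm (1 + s) 2)))))
                   (++-assoc (rep (1 + s) 1) (1 ∷ 1 ∷ []) [ 2 ])
    reassociate₁ : ∀ (O' R a b : List ℕ) →
      ((b ++ O') ++ a ++ b) ++ ((O' ++ a ++ b ++ b) ++ ((O' ++ a ++ (R ++ O'))
        ++ ((b ++ a ++ (b ++ O') ++ a) ++ (((b ++ O') ++ a ++ b) ++ []))))
      ≡ ((b ++ O') ++ a) ++ (((b ++ O') ++ a) ++ (b ++ ((((b ++ O') ++ a) ++ R)
        ++ (((O' ++ b) ++ a) ++ (((b ++ O') ++ a) ++ (((b ++ O') ++ a) ++ b))))))
    reassociate₁ O' R a b = solve-monoid (++-monoid ℕ)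
    reassociate₂ : ∀ (O F a b : List ℕ) →
      (O ++ a) ++ ((O ++ a) ++ (b ++ (F ++ ((O ++ a) ++ b)))) ≡ (O ++ a) ++ ((O ++ a ++ b) ++ (F ++ ((O ++ a ++ b) ++ [])))
    reassociate₂ O F a b = solve-monoid (++-monoid ℕ)
    rearrange : ∀ s → suc (suc (3 + s + 1)) ≡ 4 + s + 2
    rearrange = solve-∀

-- The letter j = 3 + i of the alphabet of t = 4 + (i + u), so that t − j = 1 + u.
module MiddleLetter (i u : ℕ) where
  private
    t j : ℕ
    t = 4 + (i + u)
    j = 3 + i

    j<t : j < t
    j<t = s≤s (s≤s (s≤s (s≤s (m≤m+n i u))))

    t∸j≡1+u : t ∸ j ≡ suc u
    t∸j≡1+u = trans (cong (_∸ i) (sym (+-suc i u))) (m+n∸m≡n i (suc u))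

    [2+u]+[1+i]≡t∸1 : 2 + u + suc i ≡ 3 + (i + u)
    [2+u]+[1+i]≡t∸1 = cong (λ z → suc (suc z)) (trans (+-suc u i) (cong suc (+-comm u i)))

    ρ-j : ρ t j ≡ 1
    ρ-j = ρ-small t j j<t

    ρ-t+1 : ρ t (suc t) ≡ 2
    ρ-t+1 = ρ-large t (suc t) (n≤1+n t)

    ζ-t+1 : ζ t (suc t) ≡ 1 ∷ 2 ∷ rep (3 + (i + u)) 1 ++ [ 2 ]
    ζ-t+1 rewrite ≤ᵇ-true {t} {suc t} (n≤1+n t) | ≡ᵇ-false {suc t} {t} (λ e → <-irrefl (sym e) (n<1+n t)) = refl

    ζ-j : ζ t j ≡ rep (suc u) 1 ++ 2 ∷ rep j 1
    ζ-j = trans (ζ-small t j j<t) (cong (λ z → rep z 1 ++ 2 ∷ rep j 1) t∸j≡1+u)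

    j≢t : (j ≡ᵇ t) ≡ false
    j≢t = ≡ᵇ-false (<⇒≢ j<t)

    j≢t+1 : (j ≡ᵇ t + 1) ≡ false
    j≢t+1 = ≡ᵇ-false (<⇒≢ (≤-trans j<t (m≤m+n t 1)))

    j≤t∸1 : (j ≤ᵇ t ∸ 1) ≡ true
    j≤t∸1 = ≤ᵇ-true (s≤s (s≤s (s≤s (m≤m+n i u))))

    τ-j : τgen t j ≡ run 1 (2 + u) ++ run (2 + u) (1 + i) ++ [ suc t ]
    τ-j rewrite j≢t | j≢t+1 | j≤t∸1 = segments (t ∸ j + 1) (trans (cong (_+ 1) t∸j≡1+u) (+-comm (suc u) 1))
      where
      segments : ∀ k → k ≡ 2 + u → seg 1 k ++ seg k (t ∸ 2) ++ [ t + 1 ] ≡ run 1 (2 + u) ++ run (2 + u) (1 + i) ++ [ suc t ]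
      segments k refl = cong₂ _++_ (map-upTo (1 +_) (2 + u))
        (cong₂ _++_ (trans (cong (λ z → map (2 + u +_) (upTo z)) (m+n∸n≡m (suc i) u)) (map-upTo (2 + u +_) (1 + i)))
                    (cong [_] (+-comm t 1)))

    δ-j : δgen t j ≡ rep (suc u) 1 ++ 2 ∷ rep (suc i) 1 ++ [ 2 ]
    δ-j rewrite j≢t | j≢t+1 | j≤t∸1 = cong (λ z → rep z 1 ++ 2 ∷ rep (suc i) 1 ++ [ 2 ]) t∸j≡1+u

    run₁ run₂ : List ℕ
    run₁ = run 1 (2 + u)
    run₂ = run (2 + u) (1 + i)

    ρ∘τ : map (ρ t) (τgen t j) ≡ φ t (ρ t j)
    ρ∘τ = begin
      map (ρ t) (τgen t j)                                  ≡⟨ cong (map (ρ t)) τ-j ⟩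
      map (ρ t) (run₁ ++ run₂ ++ [ suc t ])                 ≡⟨ map-++ (ρ t) run₁ _ ⟩
      map (ρ t) run₁ ++ map (ρ t) (run₂ ++ [ suc t ])       ≡⟨ cong (map (ρ t) run₁ ++_) (map-++ (ρ t) run₂ _) ⟩
      map (ρ t) run₁ ++ map (ρ t) run₂ ++ [ ρ t (suc t) ]
        ≡⟨ cong₂ _++_ (ρ-run t 1 (2 + u) (s≤s (s≤s (s≤s (≤-trans (m≤n+m u i) (n≤1+n _))))))
                      (cong₂ (λ a b → a ++ [ b ]) (ρ-run t (2 + u) (1 + i) (≤-trans (≤-reflexive [2+u]+[1+i]≡t∸1) (n≤1+n _))) ρ-t+1) ⟩
      rep (2 + u) 1 ++ rep (1 + i) 1 ++ [ 2 ]               ≡⟨ sym (++-assoc (rep (2 + u) 1) _ _) ⟩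
      (rep (2 + u) 1 ++ rep (1 + i) 1) ++ [ 2 ]
        ≡⟨ cong (_++ [ 2 ]) (trans (replicate-++ (2 + u) (1 + i) 1) (cong (λ z → rep z 1) [2+u]+[1+i]≡t∸1)) ⟩
      φ t 1                                                 ≡⟨ cong (φ t) (sym ρ-j) ⟩
      φ t (ρ t j)                                           ∎
      where open ≡-Reasoning

  letter-middle : LetterIdentities t (τgen t) (δgen t) j
  letter-middle = record
    { σ-closed = subst (All (InAlphabet t)) (sym τ-j)
        (All-++ run₁ _ (All-run t 1 (2 + u) (s≤s z≤n) (s≤s (s≤s (s≤s (≤-trans (m≤n+m u i) (m≤n+m (i + u) 3))))))
        (All-++ run₂ _ (All-run t (2 + u) (1 + i) (s≤s z≤n) (≤-trans (≤-reflexive [2+u]+[1+i]≡t∸1) (m≤n+m _ 3)))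
                       ((s≤s z≤n , ≤-refl) ∷ [])))
    ; ρ∘σ≡φ∘ρ = ρ∘τ
    ; ζ∘σ≡φ∘ζ = begin
        concatMap (ζ t) (τgen t j)
          ≡⟨ cong (concatMap (ζ t)) τ-j ⟩
        concatMap (ζ t) (run₁ ++ run₂ ++ [ suc t ])
          ≡⟨ concatMap-++ (ζ t) run₁ _ ⟩
        concatMap (ζ t) run₁ ++ concatMap (ζ t) (run₂ ++ [ suc t ])
          ≡⟨ cong (concatMap (ζ t) run₁ ++_) (concatMap-++ (ζ t) run₂ [ suc t ]) ⟩
        concatMap (ζ t) run₁ ++ (concatMap (ζ t) run₂ ++ (ζ t (suc t) ++ []))
          ≡⟨ cong₂ _++_ (ζ-run t 1 (1 + u) (s≤s z≤n) (s≤s (s≤s (s≤s (≤-trans (m≤n+m u i) (n≤1+n _))))))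
               (cong₂ (λ X Y → X ++ (Y ++ [])) (ζ-run t (2 + u) i (s≤s z≤n) (≤-trans (≤-reflexive (cong (λ z → 3 + z) (+-comm u i))) (n≤1+n _))) ζ-t+1) ⟩
        (O ++ [ 2 ] ++ (φ1ⁿ t (1 + u) ++ Q₁)) ++ ((Q₂ ++ [ 2 ] ++ (φ1ⁿ t i ++ Q₃)) ++ (([ 1 ] ++ [ 2 ] ++ O ++ [ 2 ]) ++ []))
          ≡⟨ reassociate₁ O (φ1ⁿ t (1 + u)) Q₁ Q₂ (φ1ⁿ t i) Q₃ [ 2 ] [ 1 ] ⟩
        (O ++ [ 2 ]) ++ (φ1ⁿ t (1 + u) ++ ((Q₁ ++ Q₂) ++ ([ 2 ] ++ (φ1ⁿ t i ++ ((Q₃ ++ [ 1 ]) ++ ([ 2 ] ++ ((O ++ [ 2 ]) ++ [])))))))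
          ≡⟨ cong₂ (λ X Y → (O ++ [ 2 ]) ++ (φ1ⁿ t (1 + u) ++ (X ++ ([ 2 ] ++ (φ1ⁿ t i ++ (Y ++ ([ 2 ] ++ ((O ++ [ 2 ]) ++ []))))))))
                   Q₁Q₂≡1O Q₃1≡O ⟩
        (O ++ [ 2 ]) ++ (φ1ⁿ t (1 + u) ++ (([ 1 ] ++ O) ++ ([ 2 ] ++ (φ1ⁿ t i ++ (O ++ ([ 2 ] ++ ((O ++ [ 2 ]) ++ [])))))))
          ≡⟨ reassociate₂ O (φ1ⁿ t (1 + u)) (φ1ⁿ t i) [ 2 ] [ 1 ] ⟩
        φ1ⁿ t (2 + u) ++ ([ 1 ] ++ (φ1ⁿ t (1 + i) ++ (Φ ++ Φ)))
          ≡⟨ cong₂ (λ A B → A ++ ([ 1 ] ++ B)) (sym (φ1ⁿ-suc t (1 + u))) (trans (φ1ⁿ-suc-++ t (1 + i) Φ) (φ1ⁿ-suc t (2 + i))) ⟩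
        (φ1ⁿ t (1 + u) ++ Φ) ++ ([ 1 ] ++ φ1ⁿ t j)
          ≡⟨ reassociate₃ O (φ1ⁿ t (1 + u)) (φ1ⁿ t j) [ 2 ] [ 1 ] ⟩
        φ1ⁿ t (1 + u) ++ (φ t 2 ++ φ1ⁿ t j)
          ≡⟨ cong (λ z → φ1ⁿ t (1 + u) ++ (φ t 2 ++ z)) (sym (concatMap-φ-1ⁿ t j)) ⟩
        φ1ⁿ t (1 + u) ++ concatMap (φ t) (2 ∷ rep j 1)
          ≡⟨ sym (concatMap-φ-1ⁿ++ t (1 + u) (2 ∷ rep j 1)) ⟩
        concatMap (φ t) (rep (1 + u) 1 ++ 2 ∷ rep j 1)
          ≡⟨ cong (concatMap (φ t)) (sym ζ-j) ⟩
        concatMap (φ t) (ζ t j) ∎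
    ; d≡blockSums = trans δ-j (sym (begin
        blockSums (ζ t j) (map (ρ t) (τgen t j))                        ≡⟨ cong₂ blockSums ζ-j (trans ρ∘τ (cong (φ t) ρ-j)) ⟩
        blockSums (A ++ 2 ∷ rep j 1) (rep (3 + (i + u)) 1 ++ [ 2 ])       ≡⟨ cong₂ (λ X Y → blockSums (A ++ 2 ∷ X) Y) 1ʲ≡ 1ᵗ⁻¹2≡ ⟩
        blockSums (A ++ 2 ∷ (B ++ 1 ∷ 1 ∷ [])) (A ++ 1 ∷ (B ++ [ 2 ]))   ≡⟨ blockSums-replicate1 (suc u) _ _ ⟩
        A ++ 2 ∷ blockSums (B ++ 1 ∷ 1 ∷ []) (B ++ [ 2 ])                ≡⟨ cong (λ z → A ++ 2 ∷ z) (blockSums-replicate1 (suc i) (1 ∷ 1 ∷ []) [ 2 ]) ⟩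
        A ++ 2 ∷ (B ++ [ 2 ])                                           ∎))
    ; length-ζ = trans (cong length ζ-j) (trans (length-1ⁿ++ (suc u) _)
                   (trans (cong (λ z → suc u + suc z) (length-replicate j)) (trans (rearrange i u) (cong (t +_) (sym ρ-j)))))
    }
    where
    open ≡-Reasoning
    O = rep (3 + (i + u)) 1
    Φ = φ t 1
    Q₁ = rep (2 + u) 1
    Q₂ = rep (t ∸ (2 + u)) 1
    Q₃ = rep (2 + u + i) 1
    A = rep (suc u) 1
    B = rep (suc i) 1
    Q₁Q₂≡1O : Q₁ ++ Q₂ ≡ [ 1 ] ++ O
    Q₁Q₂≡1O = trans (replicate-++ (2 + u) (t ∸ (2 + u)) 1)
                    (cong (λ z → rep z 1) (m+[n∸m]≡n (≤-trans (s≤s (s≤s (m≤n+m u i))) (≤-trans (n≤1+n _) (n≤1+n _)))))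
    Q₃1≡O : Q₃ ++ [ 1 ] ≡ O
    Q₃1≡O = trans (replicate-∷ʳ (2 + u + i) 1) (cong (λ z → rep (3 + z) 1) (+-comm u i))
    1ʲ≡ : rep j 1 ≡ B ++ 1 ∷ 1 ∷ []
    1ʲ≡ = sym (trans (replicate-++ (suc i) 2 1) (cong (λ z → rep z 1) (+-comm (suc i) 2)))
    1ᵗ⁻¹2≡ : O ++ [ 2 ] ≡ A ++ 1 ∷ (B ++ [ 2 ])
    1ᵗ⁻¹2≡ = trans (cong (_++ [ 2 ]) (sym (trans (replicate-++ (suc u) (2 + i) 1) (cong (λ z → rep z 1) sizes))))
                   (++-assoc A (1 ∷ B) [ 2 ])
      where
      sizes : suc u + (2 + i) ≡ 3 + (i + u)
      sizes = cong suc (trans (+-suc u (suc i)) (cong suc (trans (+-suc u i) (cong suc (+-comm u i)))))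
    reassociate₁ : ∀ (O P₁ R₁ R₂ Pᵢ R₃ a b : List ℕ) →
      (O ++ a ++ (P₁ ++ R₁)) ++ ((R₂ ++ a ++ (Pᵢ ++ R₃)) ++ ((b ++ a ++ O ++ a) ++ []))
      ≡ (O ++ a) ++ (P₁ ++ ((R₁ ++ R₂) ++ (a ++ (Pᵢ ++ ((R₃ ++ b) ++ (a ++ ((O ++ a) ++ [])))))))
    reassociate₁ O P₁ R₁ R₂ Pᵢ R₃ a b = solve-monoid (++-monoid ℕ)
    reassociate₂ : ∀ (O P₁ Pᵢ a b : List ℕ) →
      (O ++ a) ++ (P₁ ++ ((b ++ O) ++ (a ++ (Pᵢ ++ (O ++ (a ++ ((O ++ a) ++ [])))))))
      ≡ ((O ++ a) ++ P₁) ++ (b ++ (((O ++ a) ++ Pᵢ) ++ ((O ++ a) ++ (O ++ a))))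
    reassociate₂ O P₁ Pᵢ a b = solve-monoid (++-monoid ℕ)
    reassociate₃ : ∀ (O P₁ F a b : List ℕ) → (P₁ ++ (O ++ a)) ++ (b ++ F) ≡ P₁ ++ ((O ++ a ++ b) ++ F)
    reassociate₃ O P₁ F a b = solve-monoid (++-monoid ℕ)
    rearrange : ∀ i u → suc u + suc (3 + i) ≡ 4 + (i + u) + 1
    rearrange = solve-∀

data LetterOf4+ : ℕ → ℕ → Set where
  one : ∀ {s} → LetterOf4+ s 1
  two : ∀ {s} → LetterOf4+ s 2
  middle : ∀ i u → LetterOf4+ (i + u) (3 + i)
  top : ∀ {s} → LetterOf4+ s (4 + s)
  top+1 : ∀ {s} → LetterOf4+ s (5 + s)

classify : ∀ s j → InAlphabet (4 + s) j → LetterOf4+ s j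
classify s zero (() , _)
classify s 1 _ = one
classify s 2 _ = two
classify s (suc (suc (suc i))) (_ , j≤) with i ≤? s
... | yes i≤s = subst (λ s' → LetterOf4+ s' (3 + i)) (m+[n∸m]≡n i≤s) (middle i (s ∸ i))
... | no i≰s with m≤n⇒m<n∨m≡n (≰⇒> i≰s)
...   | inj₂ 1+s≡i = subst (λ z → LetterOf4+ s (3 + z)) 1+s≡i top
...   | inj₁ 1+s<i = subst (λ z → LetterOf4+ s (3 + z)) (≤-antisym 1+s<i (≤-pred (≤-pred (≤-pred j≤)))) top+1

letterwise-4+ : ∀ s j → LetterOf4+ s j → LetterIdentities (4 + s) (τgen (4 + s)) (δgen (4 + s)) j
letterwise-4+ s _ one = SpecialLetters.letter-1 s
letterwise-4+ s _ two = SpecialLetters.letter-2 s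
letterwise-4+ _ _ (middle i u) = MiddleLetter.letter-middle i u
letterwise-4+ s _ top = SpecialLetters.letter-t s
letterwise-4+ s _ top+1 = SpecialLetters.letter-t+1 s

admissible-4+ : ∀ s → Admissible (4 + s) (τ (4 + s)) (δ (4 + s))
admissible-4+ s = record
  { σ1-tail = _
  ; σ1≡1∷tail = refl
  ; ζ1≡φ1∷ʳ1 = sym (++-assoc (rep (3 + s) 1) [ 2 ] [ 1 ])
  ; letterwise = λ j j∈ → letterwise-4+ s j (classify s j j∈)
  }

theorem2 : (t : ℕ) → 2 ≤ t → (A : ℕ → ℕ) → (∀ n → 1 ≤ n → IsFloorα t n (A n)) →
    ∃[ x ] ((∀ i → (1 ≤ x i) × (x i ≤ suc t)) × IsImage (τ t) x x × IsImage (δ t) x (ΔAA A))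
theorem2 (suc zero) (s≤s ())
theorem2 (suc (suc zero)) _ = FixedPoint.fixedPoint-decorates-ΔAA 0 admissible-2
theorem2 (suc (suc (suc zero))) _ = FixedPoint.fixedPoint-decorates-ΔAA 1 admissible-3
theorem2 (suc (suc (suc (suc s)))) _ = FixedPoint.fixedPoint-decorates-ΔAA (2 + s) (admissible-4+ s)
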